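{- Consider the Set Identification problem with parameter $\beta \in (0,1)$ rational, ground set $\mathcal{N}$ of size $n$, $k = \beta n$, and a non-empty collection $\mathcal{C}$ of $k$-element subsets of $\mathcal{N}$. For every $\alpha \in (\beta, 1]$, any deterministic $\alpha$-approximation algorithm for this problem must make (on some choice of hidden set $C^* \in \mathcal{C}$) at least \[\frac{(k + 1) \cdot [2(\alpha - \beta)^2 + \ln \beta + (\beta^{ -1} - 1) \ln (1 - \beta) - k^{ -1}\ln n] + \ln |\mathcal{C}|}{\ln (k + 1)}\] oracle queries.
   Context: Set Identification: an algorithm knows $\mathcal{N}$ and $\mathcal{C}$; there is a hidden set $C^* \in \mathcal{C}$, accessible only through an oracle that, given any $S \subseteq \mathcal{N}$, returns $|S \cap C^*|$. The algorithm must output a set $S \subseteq \mathcal{N}$ of size $k$; it is an $\alpha$-approximation algorithm if for every $C^* \in \mathcal{C}$ its output satisfies $|S \cap C^*| \geq \alpha k$.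
   Formalization: The approximation ratio α ranges only over the rationals in the interval $(\beta, 1]$. -}

module Defs where

open import Data.Nat as ℕ using (ℕ; zero; suc; _!)
open import Data.Nat.Properties using (_!≢0)
open import Data.Integer using (+_)
open import Data.Rational using (ℚ; 1ℚ; 0ℚ; _/_; _*_; _+_; _-_; _≤_)
open import Data.Fin.Subset using (Subset; _∩_; ∣_∣)
open import Data.List using (List; length)
open import Data.List.Membership.Propositional using (_∈_)

⟦_⟧ : ℕ → ℚ
⟦ m ⟧ = + m / 1

_^ℚ_ : ℚ → ℕ → ℚ
x ^ℚ zero = 1ℚ
x ^ℚ suc m = x * (x ^ℚ m)

expPartial : ℚ → ℕ → ℚ
expPartial x zero = 1ℚ
expPartial x (suc m) = expPartial x m + (x ^ℚ suc m) * (_/_ (+ 1) (suc m !) {{suc m !≢0}})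

-- For x ≥ 0:  exp(x) * p ≤ r   (p ≥ 0)  iff every partial sum satisfies it.
ExpMulLe : ℚ → ℚ → ℚ → Set
ExpMulLe x p r = ∀ m → expPartial x m * p ≤ r

-- A deterministic adaptive algorithm over ground set Fin n:
-- a decision tree which either outputs a set, or queries a set S and
-- continues depending on the oracle answer |S ∩ C*|.
data Alg (n : ℕ) : Set where
  output : Subset n → Alg n
  query  : Subset n → (ℕ → Alg n) → Alg n

run : ∀ {n} → Alg n → Subset n → Subset n
run (output S)  C* = S
run (query S f) C* = run (f ∣ S ∩ C* ∣) C*

queries : ∀ {n} → Alg n → Subset n → ℕ
queries (output S)  C* = 0
queries (query S f) C* = suc (queries (f ∣ S ∩ C* ∣) C*)

IsApprox : ∀ {n} → ℕ → List (Subset n) → ℚ → Alg n → Set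
IsApprox k 𝒞 α A = ∀ C* → C* ∈ 𝒞 →
  (∣ run A C* ∣ ≡ k) × (α * ⟦ k ⟧ ≤ ⟦ ∣ run A C* ∩ C* ∣ ⟧)
  where
  open import Relation.Binary.PropositionalEquality using (_≡_)
  open import Data.Product using (_×_)

-- The lower bound of Proposition 2, multiplied by k and exponentiated:
--   q ≥ [(k+1)(2(α-β)² + ln β + (β⁻¹-1) ln(1-β) - k⁻¹ ln n) + ln c] / ln(k+1)
-- iff  exp(2k(k+1)(α-β)²) · β^{k(k+1)} · (1-β)^{(k+1)(n-k)} · c^k ≤ (k+1)^{kq} · n^{k+1}
-- (using k(k+1)(β⁻¹-1) = (k+1)(n-k) when k = βn, k ≥ 1).
QueryLowerBound : (β α : ℚ) (n k c q : ℕ) → Set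
QueryLowerBound β α n k c q =
  ExpMulLe (⟦ 2 ℕ.* k ℕ.* (k ℕ.+ 1) ⟧ * ((α - β) * (α - β)))
           ((β ^ℚ (k ℕ.* (k ℕ.+ 1))) * ((1ℚ - β) ^ℚ ((k ℕ.+ 1) ℕ.* (n ℕ.∸ k))) * (⟦ c ⟧ ^ℚ k))
           ((⟦ k ℕ.+ 1 ⟧ ^ℚ (k ℕ.* q)) * (⟦ n ⟧ ^ℚ (k ℕ.+ 1)))

{-# OPTIONS --safe #-}
-- Give every element of the ground set probability β independently, so that a k-set C has
-- weight β^k (1-β)^(n-k).  For a fixed output S, the hidden sets C with |S ∩ C| ≥ αk have total
-- weight at most exp(-2k(α-β)²): exponentially tilting the coordinates of S gives the Chernoff
-- bound exp(-k KL(v ‖ β)) with v ≥ α, and Pinsker's inequality KL(v ‖ β) ≥ 2(v-β)² finishes it.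
-- A deterministic algorithm making at most q queries, each answered by a number in {0,…,k}, is a
-- decision tree with at most (k+1)^q leaves, so one output serves at least |𝒞| / (k+1)^q hidden
-- sets; comparing the two counts gives the bound.
-- Without real exponentials, exp is replaced by its partial sums, and Pinsker's inequality is
-- proved from a discrete monotonicity principle: a function that loses at most a quadratic
-- amount over every short step is nondecreasing.
module Submission where

open import Defs

module RationalArithmetic where

  open import Algebra.Bundles using (CommutativeRing)
  open import Data.Nat.Base as ℕ using (ℕ; zero; suc)
  import Data.Nat.Properties as ℕ
  open import Data.Integer.Base as ℤ using (+_; -[1+_]; 1ℤ)
  import Data.Integer.Properties as ℤ
  open import Data.Integer.Tactic.RingSolver as ℤ-Solver using ()
  open import Data.Rational.Base
  open import Data.Rational.Properties
  import Data.Rational.Unnormalised.Base as ℚᵘ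
  import Data.Rational.Unnormalised.Properties as ℚᵘ
  open import Data.Nat.Coprimality as C using ()
  open import Data.Product.Base using (∃; _,_; proj₁; proj₂)
  open import Data.Sum.Base using (inj₁; inj₂)
  open import Level using (0ℓ)
  open import Relation.Binary.PropositionalEquality
  open import Relation.Nullary.Decidable.Core using (dec⇒maybe)
  open import Tactic.RingSolver using (solve-∀)
  import Tactic.RingSolver.Core.AlmostCommutativeRing as ACR
  import Algebra.Properties.CommutativeSemiring.Exp as Exp

  ℚ-ring : ACR.AlmostCommutativeRing 0ℓ 0ℓ
  ℚ-ring = ACR.fromCommutativeRing +-*-commutativeRing (λ x → dec⇒maybe (0ℚ ≟ x))

  0≤1 : 0ℚ ≤ 1ℚ
  0≤1 = *≤* (ℤ.+≤+ ℕ.z≤n)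

  private
    variable
      p q r s : ℚ

  *-monoˡ-≤ : 0ℚ ≤ r → p ≤ q → r * p ≤ r * q
  *-monoˡ-≤ {r} 0≤r = *-monoˡ-≤-nonNeg r {{nonNegative 0≤r}}

  *-monoʳ-≤ : 0ℚ ≤ r → p ≤ q → p * r ≤ q * r
  *-monoʳ-≤ {r} 0≤r = *-monoʳ-≤-nonNeg r {{nonNegative 0≤r}}

  *-mono-≤ : 0ℚ ≤ q → 0ℚ ≤ r → p ≤ q → r ≤ s → p * r ≤ q * s
  *-mono-≤ 0≤q 0≤r p≤q r≤s = ≤-trans (*-monoʳ-≤ 0≤r p≤q) (*-monoˡ-≤ 0≤q r≤s)

  *-pres-0≤ : 0ℚ ≤ p → 0ℚ ≤ q → 0ℚ ≤ p * q
  *-pres-0≤ {p} {q} 0≤p 0≤q = nonNegative⁻¹ (p * q)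
    {{nonNeg*nonNeg⇒nonNeg p {{nonNegative 0≤p}} q {{nonNegative 0≤q}}}}

  *-pres-0< : 0ℚ < p → 0ℚ < q → 0ℚ < p * q
  *-pres-0< {p} {q} 0<p 0<q = positive⁻¹ (p * q)
    {{pos*pos⇒pos p {{positive 0<p}} q {{positive 0<q}}}}

  square-nonNeg : ∀ p → 0ℚ ≤ p * p
  square-nonNeg p with ≤-total 0ℚ p
  ... | inj₁ 0≤p = *-pres-0≤ 0≤p 0≤p
  ... | inj₂ p≤0 = subst (0ℚ ≤_) (neg*neg p) (*-pres-0≤ (neg-antimono-≤ p≤0) (neg-antimono-≤ p≤0))
    where
    neg*neg : ∀ p → (- p) * (- p) ≡ p * p
    neg*neg = solve-∀ ℚ-ring

  p≤q⇒0≤q-p : ∀ {p q} → p ≤ q → 0ℚ ≤ q - p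
  p≤q⇒0≤q-p {p} {q} p≤q = subst (_≤ q - p) (+-inverseʳ p) (+-monoˡ-≤ (- p) p≤q)

  p<q⇒0<q-p : ∀ {p q} → p < q → 0ℚ < q - p
  p<q⇒0<q-p {p} {q} p<q = subst (_< q - p) (+-inverseʳ p) (+-monoˡ-< (- p) p<q)

  0≤q-p⇒p≤q : ∀ {p q} → 0ℚ ≤ q - p → p ≤ q
  0≤q-p⇒p≤q {p} {q} 0≤q-p = subst₂ _≤_ (+-identityʳ p) (p+[q-p]≡q p q) (+-monoʳ-≤ p 0≤q-p)
    where
    p+[q-p]≡q : ∀ p q → p + (q - p) ≡ q
    p+[q-p]≡q = solve-∀ ℚ-ring

  ≤-by-difference : ∀ e → q - p ≡ e → 0ℚ ≤ e → p ≤ q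
  ≤-by-difference e q-p≡e 0≤e = 0≤q-p⇒p≤q (subst (0ℚ ≤_) (sym q-p≡e) 0≤e)

  ⟦⟧-via-ℚᵘ : ∀ {m p} → ℚᵘ.mkℚᵘ (+ m) 0 ℚᵘ.≃ toℚᵘ p → ⟦ m ⟧ ≡ p
  ⟦⟧-via-ℚᵘ {m} eq = toℚᵘ-injective (ℚᵘ.≃-trans (toℚᵘ-fromℚᵘ (ℚᵘ.mkℚᵘ (+ m) 0)) eq)

  toℚᵘ-⟦⟧ : ∀ m → ℚᵘ.mkℚᵘ (+ m) 0 ℚᵘ.≃ toℚᵘ ⟦ m ⟧
  toℚᵘ-⟦⟧ m = ℚᵘ.≃-sym (toℚᵘ-fromℚᵘ (ℚᵘ.mkℚᵘ (+ m) 0))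

  ⟦⟧-homo-+ : ∀ m n → ⟦ m ℕ.+ n ⟧ ≡ ⟦ m ⟧ + ⟦ n ⟧
  ⟦⟧-homo-+ m n = ⟦⟧-via-ℚᵘ {m ℕ.+ n} (ℚᵘ.≃-trans (ℚᵘ.*≡* (trans (cong (ℤ._* + 1) (ℤ.pos-+ m n)) (identity (+ m) (+ n))))
    (ℚᵘ.≃-trans (ℚᵘ.+-cong (toℚᵘ-⟦⟧ m) (toℚᵘ-⟦⟧ n)) (ℚᵘ.≃-sym (toℚᵘ-homo-+ ⟦ m ⟧ ⟦ n ⟧))))
    where
    identity : ∀ a b → (a ℤ.+ b) ℤ.* + 1 ≡ (a ℤ.* + 1 ℤ.+ b ℤ.* + 1) ℤ.* + 1
    identity = ℤ-Solver.solve-∀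

  ⟦⟧-homo-* : ∀ m n → ⟦ m ℕ.* n ⟧ ≡ ⟦ m ⟧ * ⟦ n ⟧
  ⟦⟧-homo-* m n = ⟦⟧-via-ℚᵘ {m ℕ.* n} (ℚᵘ.≃-trans (ℚᵘ.*≡* (cong (ℤ._* + 1) (ℤ.pos-* m n)))
    (ℚᵘ.≃-trans (ℚᵘ.*-cong (toℚᵘ-⟦⟧ m) (toℚᵘ-⟦⟧ n)) (ℚᵘ.≃-sym (toℚᵘ-homo-* ⟦ m ⟧ ⟦ n ⟧))))

  ⟦suc⟧ : ∀ m → ⟦ suc m ⟧ ≡ 1ℚ + ⟦ m ⟧
  ⟦suc⟧ = ⟦⟧-homo-+ 1

  ⟦⟧-nonNeg : ∀ m → 0ℚ ≤ ⟦ m ⟧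
  ⟦⟧-nonNeg m = nonNegative⁻¹ ⟦ m ⟧ {{normalize-nonNeg m 1}}

  ⟦⟧-pos : ∀ m .{{_ : ℕ.NonZero m}} → 0ℚ < ⟦ m ⟧
  ⟦⟧-pos m = positive⁻¹ ⟦ m ⟧ {{normalize-pos m 1}}

  ⟦⟧-mono-≤ : ∀ {m n} → m ℕ.≤ n → ⟦ m ⟧ ≤ ⟦ n ⟧
  ⟦⟧-mono-≤ {m} m≤n with ℕ.m≤n⇒∃[o]m+o≡n m≤n
  ... | o , refl = subst (_≤ ⟦ m ℕ.+ o ⟧) (+-identityʳ ⟦ m ⟧)
    (subst (⟦ m ⟧ + 0ℚ ≤_) (sym (⟦⟧-homo-+ m o)) (+-monoʳ-≤ ⟦ m ⟧ (⟦⟧-nonNeg o)))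

  ⟦⟧-mono-< : ∀ {m n} → m ℕ.< n → ⟦ m ⟧ < ⟦ n ⟧
  ⟦⟧-mono-< {m} m<n = <-≤-trans m<1+m (⟦⟧-mono-≤ m<n)
    where
    m<1+m : ⟦ m ⟧ < ⟦ suc m ⟧
    m<1+m = subst₂ _<_ (+-identityˡ ⟦ m ⟧) (sym (⟦suc⟧ m)) (+-monoˡ-< ⟦ m ⟧ (⟦⟧-pos 1))

  ⟦⟧-homo-^ : ∀ m n → ⟦ m ⟧ ^ℚ n ≡ ⟦ m ℕ.^ n ⟧
  ⟦⟧-homo-^ m zero    = refl
  ⟦⟧-homo-^ m (suc n) = trans (cong (⟦ m ⟧ *_) (⟦⟧-homo-^ m n)) (sym (⟦⟧-homo-* m (m ℕ.^ n)))

  ⟦⟧*1/⟦⟧≡1 : ∀ n .{{_ : ℕ.NonZero n}} → ⟦ n ⟧ * (1ℤ / n) ≡ 1ℚ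
  ⟦⟧*1/⟦⟧≡1 (suc n) = toℚᵘ-injective (ℚᵘ.≃-trans (toℚᵘ-homo-* ⟦ suc n ⟧ (1ℤ / suc n))
    (ℚᵘ.≃-trans (ℚᵘ.*-cong (ℚᵘ.≃-sym (toℚᵘ-⟦⟧ (suc n))) (toℚᵘ-fromℚᵘ (ℚᵘ.mkℚᵘ (+ 1) n)))
      (ℚᵘ.*≡* (identity (+ suc n)))))
    where
    identity : ∀ a → (a ℤ.* + 1) ℤ.* + 1 ≡ + 1 ℤ.* (+ 1 ℤ.* a)
    identity = ℤ-Solver.solve-∀

  ⟦⟧-unbounded : ∀ p → ∃ λ N → p < ⟦ N ⟧
  ⟦⟧-unbounded (mkℚ -[1+ _ ] _ _) = 1 , *<* ℤ.-<+
  ⟦⟧-unbounded p@(mkℚ (+ m) d-1 _) = suc m ,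
    subst (p <_) (sym (normalize-coprime (C.sym (C.1-coprimeTo (suc m)))))
      (*<* (subst₂ ℤ._<_ (ℤ.pos-* m 1) (ℤ.pos-* (suc m) (suc d-1)) (ℤ.+<+ m*1<[1+m]*[1+d])))
    where
    m*1<[1+m]*[1+d] : m ℕ.* 1 ℕ.< suc m ℕ.* suc d-1
    m*1<[1+m]*[1+d] = ℕ.≤-trans (ℕ.s≤s (ℕ.≤-reflexive (ℕ.*-identityʳ m))) (ℕ.m≤m*n (suc m) (suc d-1))

  archimedean : ∀ {δ} → 0ℚ < δ → ∀ p → ∃ λ N → p < ⟦ N ⟧ * δ
  archimedean {δ} 0<δ p = N , subst (_< ⟦ N ⟧ * δ) p/δ*δ≡p (*-monoˡ-<-pos δ {{positive 0<δ}} p/δ<N)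
    where
    instance
      δ≢0 : NonZero δ
      δ≢0 = pos⇒nonZero δ {{positive 0<δ}}
    N : ℕ
    N = proj₁ (⟦⟧-unbounded (p * 1/ δ))
    p/δ<N : p * 1/ δ < ⟦ N ⟧
    p/δ<N = proj₂ (⟦⟧-unbounded (p * 1/ δ))
    p/δ*δ≡p : p * 1/ δ * δ ≡ p
    p/δ*δ≡p = trans (*-assoc p (1/ δ) δ) (trans (cong (p *_) (*-inverseˡ δ)) (*-identityʳ p))

  module _ where
    open Exp (CommutativeRing.commutativeSemiring +-*-commutativeRing)

    ^ℚ≡^ : ∀ x n → x ^ℚ n ≡ x ^ n
    ^ℚ≡^ x zero    = refl
    ^ℚ≡^ x (suc n) = cong (x *_) (^ℚ≡^ x n)

    ^ℚ-homo-* : ∀ x m n → x ^ℚ (m ℕ.+ n) ≡ x ^ℚ m * x ^ℚ n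
    ^ℚ-homo-* x m n rewrite ^ℚ≡^ x (m ℕ.+ n) | ^ℚ≡^ x m | ^ℚ≡^ x n = ^-homo-* x m n

    ^ℚ-assocʳ : ∀ x m n → (x ^ℚ m) ^ℚ n ≡ x ^ℚ (m ℕ.* n)
    ^ℚ-assocʳ x m n rewrite ^ℚ≡^ (x ^ℚ m) n | ^ℚ≡^ x m | ^ℚ≡^ x (m ℕ.* n) = ^-assocʳ x m n

    ^ℚ-distrib-* : ∀ x y n → (x * y) ^ℚ n ≡ x ^ℚ n * y ^ℚ n
    ^ℚ-distrib-* x y n rewrite ^ℚ≡^ (x * y) n | ^ℚ≡^ x n | ^ℚ≡^ y n = ^-distrib-* x y n

  1^ℚ : ∀ n → 1ℚ ^ℚ n ≡ 1ℚ
  1^ℚ zero    = refl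
  1^ℚ (suc n) = trans (*-identityˡ _) (1^ℚ n)

  ^ℚ-pres-0≤ : ∀ {x} n → 0ℚ ≤ x → 0ℚ ≤ x ^ℚ n
  ^ℚ-pres-0≤ zero    _   = 0≤1
  ^ℚ-pres-0≤ (suc n) 0≤x = *-pres-0≤ 0≤x (^ℚ-pres-0≤ n 0≤x)

  ^ℚ-pres-0< : ∀ {x} n → 0ℚ < x → 0ℚ < x ^ℚ n
  ^ℚ-pres-0< zero    _   = ⟦⟧-pos 1
  ^ℚ-pres-0< (suc n) 0<x = *-pres-0< 0<x (^ℚ-pres-0< n 0<x)

  ^ℚ-monoˡ-≤ : ∀ {x y} n → 0ℚ ≤ x → x ≤ y → x ^ℚ n ≤ y ^ℚ n
  ^ℚ-monoˡ-≤ zero    _   _   = ≤-refl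
  ^ℚ-monoˡ-≤ (suc n) 0≤x x≤y = *-mono-≤ (≤-trans 0≤x x≤y) (^ℚ-pres-0≤ n 0≤x) x≤y (^ℚ-monoˡ-≤ n 0≤x x≤y)

  ^ℚ-≤1 : ∀ {x} n → 0ℚ ≤ x → x ≤ 1ℚ → x ^ℚ n ≤ 1ℚ
  ^ℚ-≤1 {x} n 0≤x x≤1 = subst (x ^ℚ n ≤_) (1^ℚ n) (^ℚ-monoˡ-≤ n 0≤x x≤1)

  ^ℚ-monoʳ-≤ : ∀ {x m n} → 1ℚ ≤ x → m ℕ.≤ n → x ^ℚ m ≤ x ^ℚ n
  ^ℚ-monoʳ-≤ {x} {m} 1≤x m≤n with ℕ.m≤n⇒∃[o]m+o≡n m≤n
  ... | o , refl = subst₂ _≤_ (*-identityʳ (x ^ℚ m)) (sym (^ℚ-homo-* x m o))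
    (*-monoˡ-≤ (^ℚ-pres-0≤ m 0≤x) (subst (_≤ x ^ℚ o) (1^ℚ o) (^ℚ-monoˡ-≤ o 0≤1 1≤x)))
    where
    0≤x : 0ℚ ≤ x
    0≤x = ≤-trans 0≤1 1≤x

module Convexity where

  open RationalArithmetic
  open import Data.Nat.Base as ℕ using (ℕ; zero; suc; _!)
  open import Data.Nat.Properties using (_!≢0)
  open import Data.Integer.Base using (1ℤ)
  open import Data.Rational.Base
  open import Data.Rational.Properties
  open import Relation.Binary.PropositionalEquality
  open import Tactic.RingSolver using (solve-∀)

  powDeriv : ℕ → ℚ → ℚ
  powDeriv n x = ⟦ n ⟧ * x ^ℚ (n ℕ.∸ 1)

  powDeriv-pres-0≤ : ∀ n {x} → 0ℚ ≤ x → 0ℚ ≤ powDeriv n x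
  powDeriv-pres-0≤ n 0≤x = *-pres-0≤ (⟦⟧-nonNeg n) (^ℚ-pres-0≤ (n ℕ.∸ 1) 0≤x)

  powDeriv≤n : ∀ n {x} → 0ℚ ≤ x → x ≤ 1ℚ → powDeriv n x ≤ ⟦ n ⟧
  powDeriv≤n n 0≤x x≤1 =
    subst (powDeriv n _ ≤_) (*-identityʳ ⟦ n ⟧) (*-monoˡ-≤ (⟦⟧-nonNeg n) (^ℚ-≤1 (n ℕ.∸ 1) 0≤x x≤1))

  x*powDeriv : ∀ n x → x * powDeriv n x ≡ ⟦ n ⟧ * x ^ℚ n
  x*powDeriv zero    x = identity x
    where
    identity : ∀ x → x * (0ℚ * 1ℚ) ≡ 0ℚ * 1ℚ
    identity = solve-∀ ℚ-ring
  x*powDeriv (suc n) x = identity x ⟦ suc n ⟧ (x ^ℚ n)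
    where
    identity : ∀ x m p → x * (m * p) ≡ m * (x * p)
    identity = solve-∀ ℚ-ring

  ^ℚ-tangent : ∀ n {x y} → 0ℚ ≤ x → 0ℚ ≤ y → x ^ℚ n + (y - x) * powDeriv n x ≤ y ^ℚ n
  ^ℚ-tangent zero    {x} {y} _   _   = ≤-reflexive (identity (y - x))
    where
    identity : ∀ d → 1ℚ + d * (0ℚ * 1ℚ) ≡ 1ℚ
    identity = solve-∀ ℚ-ring
  ^ℚ-tangent (suc n) {x} {y} 0≤x 0≤y = tangent-suc n
    where
    tangent-suc : ∀ n → x ^ℚ suc n + (y - x) * powDeriv (suc n) x ≤ y ^ℚ suc n
    tangent-suc zero    = ≤-reflexive (identity x y)
      where
      identity : ∀ x y → x * 1ℚ + (y - x) * (1ℚ * 1ℚ) ≡ y * 1ℚ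
      identity = solve-∀ ℚ-ring
    tangent-suc (suc n) = ≤-trans (≤-by-difference _ y*tangent-gap (*-pres-0≤ (*-pres-0≤ (⟦⟧-nonNeg (suc n))
      (square-nonNeg (y - x))) (^ℚ-pres-0≤ n 0≤x))) (*-monoˡ-≤ 0≤y (tangent-suc n))
      where
      y*tangent-gap : y * (x ^ℚ suc n + (y - x) * powDeriv (suc n) x)
                        - (x ^ℚ suc (suc n) + (y - x) * powDeriv (suc (suc n)) x)
                      ≡ ⟦ suc n ⟧ * ((y - x) * (y - x)) * x ^ℚ n
      y*tangent-gap rewrite ⟦suc⟧ (suc n) = identity x y ⟦ suc n ⟧ (x ^ℚ n)
        where
        identity : ∀ x y m p → y * (x * p + (y - x) * (m * p)) - (x * (x * p) + (y - x) * ((1ℚ + m) * (x * p)))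
                               ≡ m * ((y - x) * (y - x)) * p
        identity = solve-∀ ℚ-ring

  factorial⁻¹ : ℕ → ℚ
  factorial⁻¹ i = (1ℤ / i !) {{i !≢0}}

  factorial⁻¹-pres-0≤ : ∀ i → 0ℚ ≤ factorial⁻¹ i
  factorial⁻¹-pres-0≤ i = nonNegative⁻¹ (factorial⁻¹ i) {{normalize-nonNeg 1 (i !) {{i !≢0}}}}

  ⟦1+m⟧*factorial⁻¹ : ∀ m → ⟦ suc m ⟧ * factorial⁻¹ (suc m) ≡ factorial⁻¹ m
  ⟦1+m⟧*factorial⁻¹ m = begin
    b * f              ≡⟨ *-identityʳ (b * f) ⟨
    (b * f) * 1ℚ       ≡⟨ cong ((b * f) *_) (⟦⟧*1/⟦⟧≡1 (m !) {{m !≢0}}) ⟨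
    (b * f) * (a * g)  ≡⟨ identity a b f g ⟩
    ((b * a) * f) * g  ≡⟨ cong (λ c → (c * f) * g) (⟦⟧-homo-* (suc m) (m !)) ⟨
    (⟦ suc m ! ⟧ * f) * g ≡⟨ cong (_* g) (⟦⟧*1/⟦⟧≡1 (suc m !) {{suc m !≢0}}) ⟩
    1ℚ * g             ≡⟨ *-identityˡ g ⟩
    g                  ∎
    where
    open ≡-Reasoning
    a b f g : ℚ
    a = ⟦ m ! ⟧
    b = ⟦ suc m ⟧
    f = factorial⁻¹ (suc m)
    g = factorial⁻¹ m
    identity : ∀ a b f g → (b * f) * (a * g) ≡ ((b * a) * f) * g
    identity = solve-∀ ℚ-ring

  expPartial′ : ℚ → ℕ → ℚ
  expPartial′ x zero    = 0ℚ
  expPartial′ x (suc m) = expPartial x m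

  expPartial≡expPartial′+term : ∀ x m → expPartial x m ≡ expPartial′ x m + x ^ℚ m * factorial⁻¹ m
  expPartial≡expPartial′+term x zero    = refl
  expPartial≡expPartial′+term x (suc m) = refl

  expPartial′≤expPartial : ∀ {x} m → 0ℚ ≤ x → expPartial′ x m ≤ expPartial x m
  expPartial′≤expPartial {x} m 0≤x = subst₂ _≤_ (+-identityʳ (expPartial′ x m)) (sym (expPartial≡expPartial′+term x m))
    (+-monoʳ-≤ (expPartial′ x m) (*-pres-0≤ (^ℚ-pres-0≤ m 0≤x) (factorial⁻¹-pres-0≤ m)))

  1≤expPartial : ∀ {x} m → 0ℚ ≤ x → 1ℚ ≤ expPartial x m
  1≤expPartial zero    _   = ≤-refl
  1≤expPartial (suc m) 0≤x = ≤-trans (1≤expPartial m 0≤x) (expPartial′≤expPartial (suc m) 0≤x)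

  expPartial-pres-0≤ : ∀ {x} m → 0ℚ ≤ x → 0ℚ ≤ expPartial x m
  expPartial-pres-0≤ m 0≤x = ≤-trans 0≤1 (1≤expPartial m 0≤x)

  expPartial′-pres-0≤ : ∀ {x} m → 0ℚ ≤ x → 0ℚ ≤ expPartial′ x m
  expPartial′-pres-0≤ zero    _   = ≤-refl
  expPartial′-pres-0≤ (suc m) 0≤x = expPartial-pres-0≤ m 0≤x

  expPartial-monoˡ-≤ : ∀ {x y} m → 0ℚ ≤ x → x ≤ y → expPartial x m ≤ expPartial y m
  expPartial-monoˡ-≤ zero    _   _   = ≤-refl
  expPartial-monoˡ-≤ (suc m) 0≤x x≤y = +-mono-≤ (expPartial-monoˡ-≤ m 0≤x x≤y)
    (*-monoʳ-≤ (factorial⁻¹-pres-0≤ (suc m)) (^ℚ-monoˡ-≤ (suc m) 0≤x x≤y))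

  expPartial-zero : ∀ m → expPartial 0ℚ m ≡ 1ℚ
  expPartial-zero zero    = refl
  expPartial-zero (suc m) = cong₂ _+_ (expPartial-zero m)
    (trans (cong (_* factorial⁻¹ (suc m)) (*-zeroˡ (0ℚ ^ℚ m))) (*-zeroˡ (factorial⁻¹ (suc m))))

  expPartial-tangent : ∀ m {x y} → 0ℚ ≤ x → 0ℚ ≤ y → expPartial x m + (y - x) * expPartial′ x m ≤ expPartial y m
  expPartial-tangent zero {x} {y} _ _ = ≤-reflexive (identity (y - x))
    where
    identity : ∀ d → 1ℚ + d * 0ℚ ≡ 1ℚ
    identity = solve-∀ ℚ-ring
  expPartial-tangent (suc m) {x} {y} 0≤x 0≤y = begin
    (E x m + x ^ℚ suc m * f) + (y - x) * E x m
      ≡⟨ cong (λ e → (E x m + x ^ℚ suc m * f) + (y - x) * e) (expPartial≡expPartial′+term x m) ⟩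
    (E x m + x ^ℚ suc m * f) + (y - x) * (E′ x m + x ^ℚ m * factorial⁻¹ m)
      ≡⟨ cong (λ g → (E x m + x ^ℚ suc m * f) + (y - x) * (E′ x m + x ^ℚ m * g)) (⟦1+m⟧*factorial⁻¹ m) ⟨
    (E x m + x ^ℚ suc m * f) + (y - x) * (E′ x m + x ^ℚ m * (⟦ suc m ⟧ * f))
      ≡⟨ identity (E x m) (x ^ℚ suc m) f y x (E′ x m) (x ^ℚ m) ⟦ suc m ⟧ ⟩
    (E x m + (y - x) * E′ x m) + f * (x ^ℚ suc m + (y - x) * (⟦ suc m ⟧ * x ^ℚ m))
      ≤⟨ +-mono-≤ (expPartial-tangent m 0≤x 0≤y) (*-monoˡ-≤ (factorial⁻¹-pres-0≤ (suc m)) (^ℚ-tangent (suc m) 0≤x 0≤y)) ⟩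
    E y m + f * y ^ℚ suc m
      ≡⟨ cong (λ t → E y m + t) (*-comm f (y ^ℚ suc m)) ⟩
    E y m + y ^ℚ suc m * f ∎
    where
    open ≤-Reasoning
    E E′ : ℚ → ℕ → ℚ
    E = expPartial
    E′ = expPartial′
    f : ℚ
    f = factorial⁻¹ (suc m)
    identity : ∀ e x₁ f y x e′ xm n → (e + x₁ * f) + (y - x) * (e′ + xm * (n * f))
                                    ≡ (e + (y - x) * e′) + f * (x₁ + (y - x) * (n * xm))
    identity = solve-∀ ℚ-ring

module AlmostMonotone where

  open RationalArithmetic
  open import Data.Nat.Base as ℕ using (ℕ; zero; suc)
  import Data.Nat.Properties as ℕ
  open import Data.Integer.Base using (1ℤ)
  open import Data.Rational.Base
  open import Data.Rational.Properties
  open import Data.Empty using (⊥-elim)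
  open import Data.Product.Base using (proj₁; proj₂)
  open import Relation.Binary.PropositionalEquality
  open import Relation.Nullary.Decidable.Core using (yes; no)
  open import Tactic.RingSolver using (solve-∀)

  AlmostIncreasingOn : (u v L B : ℚ) → (ℚ → ℚ) → Set
  AlmostIncreasingOn u v L B f = ∀ {x y} → u ≤ x → x < y → y ≤ v → (y - x) * L ≤ 1ℚ →
    f x - B * ((y - x) * (y - x)) ≤ f y

  module _ {u v L B : ℚ} {f : ℚ → ℚ} (u<v : u < v) (step : AlmostIncreasingOn u v L B f) (N-1 : ℕ) where

    private
      N : ℕ
      N = suc N-1

      h : ℚ
      h = (v - u) * (1ℤ / N)

      0<h : 0ℚ < h
      0<h = *-pres-0< (p<q⇒0<q-p u<v) (positive⁻¹ (1ℤ / N) {{normalize-pos 1 N}})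

      grid : ℕ → ℚ
      grid i = u + ⟦ i ⟧ * h

      grid-suc : ∀ i → grid (suc i) ≡ grid i + h
      grid-suc i = trans (cong (λ n → u + n * h) (⟦suc⟧ i)) (identity u ⟦ i ⟧ h)
        where
        identity : ∀ u n h → u + (1ℚ + n) * h ≡ u + n * h + h
        identity = solve-∀ ℚ-ring

      N*h≡v-u : ⟦ N ⟧ * h ≡ v - u
      N*h≡v-u = trans (identity ⟦ N ⟧ (v - u) (1ℤ / N)) (trans (cong ((v - u) *_) (⟦⟧*1/⟦⟧≡1 N)) (*-identityʳ (v - u)))
        where
        identity : ∀ n d i → n * (d * i) ≡ d * (n * i)
        identity = solve-∀ ℚ-ring

      grid-N≡v : grid N ≡ v
      grid-N≡v = trans (cong (u +_) N*h≡v-u) (identity u v)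
        where
        identity : ∀ u v → u + (v - u) ≡ v
        identity = solve-∀ ℚ-ring

      u≤grid : ∀ i → u ≤ grid i
      u≤grid i = subst (_≤ grid i) (+-identityʳ u) (+-monoʳ-≤ u (*-pres-0≤ (⟦⟧-nonNeg i) (<⇒≤ 0<h)))

      grid≤v : ∀ {i} → i ℕ.≤ N → grid i ≤ v
      grid≤v {i} i≤N = subst (grid i ≤_) grid-N≡v (+-monoʳ-≤ u (*-monoʳ-≤ (<⇒≤ 0<h) (⟦⟧-mono-≤ i≤N)))

      grid<grid-suc : ∀ i → grid i < grid (suc i)
      grid<grid-suc i = subst₂ _<_ (+-identityʳ (grid i)) (sym (grid-suc i)) (+-monoʳ-< (grid i) 0<h)

      telescope : h * L ≤ 1ℚ → ∀ i → i ℕ.≤ N → f u - ⟦ i ⟧ * (B * (h * h)) ≤ f (grid i)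
      telescope hL≤1 zero    _   = ≤-reflexive (trans (identity (f u) (B * (h * h))) (cong f (sym (identity₂ u h))))
        where
        identity : ∀ a e → a - 0ℚ * e ≡ a
        identity = solve-∀ ℚ-ring
        identity₂ : ∀ a e → a + 0ℚ * e ≡ a
        identity₂ = solve-∀ ℚ-ring
      telescope hL≤1 (suc i) i<N = begin
        f u - ⟦ suc i ⟧ * e            ≡⟨ cong (λ n → f u - n * e) (⟦suc⟧ i) ⟩
        f u - (1ℚ + ⟦ i ⟧) * e         ≡⟨ identity (f u) ⟦ i ⟧ e ⟩
        (f u - ⟦ i ⟧ * e) - e          ≤⟨ +-monoˡ-≤ (- e) (telescope hL≤1 i (ℕ.<⇒≤ i<N)) ⟩
        f (grid i) - e                 ≡⟨ cong (λ d → f (grid i) - B * (d * d)) gap≡h ⟨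
        f (grid i) - B * (gap * gap)   ≤⟨ step (u≤grid i) (grid<grid-suc i) (grid≤v i<N) (subst (λ d → d * L ≤ 1ℚ) (sym gap≡h) hL≤1) ⟩
        f (grid (suc i))               ∎
        where
        open ≤-Reasoning
        e gap : ℚ
        e = B * (h * h)
        gap = grid (suc i) - grid i
        gap≡h : gap ≡ h
        gap≡h = trans (cong (_- grid i) (grid-suc i)) (identity₂ (grid i) h)
          where
          identity₂ : ∀ x h → x + h - x ≡ h
          identity₂ = solve-∀ ℚ-ring
        identity : ∀ a n e → a - (1ℚ + n) * e ≡ (a - n * e) - e
        identity = solve-∀ ℚ-ring

      telescope-to-v : h * L ≤ 1ℚ → f u - ⟦ N ⟧ * (B * (h * h)) ≤ f v
      telescope-to-v hL≤1 = subst (λ x → f u - ⟦ N ⟧ * (B * (h * h)) ≤ f x) grid-N≡v (telescope hL≤1 N ℕ.≤-refl)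

      0<N : 0ℚ < ⟦ N ⟧
      0<N = ⟦⟧-pos N

    short-steps : (v - u) * L ≤ ⟦ N ⟧ → h * L ≤ 1ℚ
    short-steps [v-u]L≤N = *-cancelˡ-≤-pos ⟦ N ⟧ {{positive 0<N}} (begin
      ⟦ N ⟧ * (h * L)   ≡⟨ *-assoc ⟦ N ⟧ h L ⟨
      ⟦ N ⟧ * h * L     ≡⟨ cong (_* L) N*h≡v-u ⟩
      (v - u) * L       ≤⟨ [v-u]L≤N ⟩
      ⟦ N ⟧             ≡⟨ *-identityʳ ⟦ N ⟧ ⟨
      ⟦ N ⟧ * 1ℚ        ∎)
      where open ≤-Reasoning

    telescope-bound : h * L ≤ 1ℚ → ⟦ N ⟧ * (f u - f v) ≤ B * ((v - u) * (v - u))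
    telescope-bound hL≤1 = begin
      ⟦ N ⟧ * (f u - f v)                ≤⟨ *-monoˡ-≤ (<⇒≤ 0<N) fu-fv≤Ne ⟩
      ⟦ N ⟧ * (⟦ N ⟧ * (B * (h * h)))    ≡⟨ identity ⟦ N ⟧ B h ⟩
      B * ((⟦ N ⟧ * h) * (⟦ N ⟧ * h))    ≡⟨ cong (λ d → B * (d * d)) N*h≡v-u ⟩
      B * ((v - u) * (v - u))            ∎
      where
      open ≤-Reasoning
      fu-fv≤Ne : f u - f v ≤ ⟦ N ⟧ * (B * (h * h))
      fu-fv≤Ne = ≤-by-difference _ (identity₂ (f u) (f v) (⟦ N ⟧ * (B * (h * h)))) (p≤q⇒0≤q-p (telescope-to-v hL≤1))
        where
        identity₂ : ∀ a b e → e - (a - b) ≡ b - (a - e)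
        identity₂ = solve-∀ ℚ-ring
      identity : ∀ n b h → n * (n * (b * (h * h))) ≡ b * ((n * h) * (n * h))
      identity = solve-∀ ℚ-ring

  -- N equal steps from u to v lose at most B (v - u)² / N in total, which is
  -- eventually smaller than f u - f v.
  almostIncreasing⇒≤ : ∀ {u v L B f} → u < v → AlmostIncreasingOn u v L B f → f u ≤ f v
  almostIncreasing⇒≤ {u} {v} {L} {B} {f} u<v step with f u ≤? f v
  ... | yes fu≤fv = fu≤fv
  ... | no  fu≰fv = ⊥-elim (<-irrefl refl (begin-strict
    ⟦ N ⟧ * δ                  ≤⟨ telescope-bound {B = B} u<v step (N₁ ℕ.+ N₂) (short-steps {B = B} u<v step (N₁ ℕ.+ N₂) [v-u]L≤N) ⟩
    B * ((v - u) * (v - u))    <⟨ proj₂ (archimedean 0<δ (B * ((v - u) * (v - u)))) ⟩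
    ⟦ N₂ ⟧ * δ                 ≤⟨ *-monoʳ-≤ (<⇒≤ 0<δ) (⟦⟧-mono-≤ (ℕ.m≤n⇒m≤1+n (ℕ.m≤n+m N₂ N₁))) ⟩
    ⟦ N ⟧ * δ                  ∎))
    where
    open ≤-Reasoning
    δ : ℚ
    δ = f u - f v
    0<δ : 0ℚ < δ
    0<δ = p<q⇒0<q-p (≰⇒> fu≰fv)
    N₁ N₂ N : ℕ
    N₁ = proj₁ (⟦⟧-unbounded ((v - u) * L))
    N₂ = proj₁ (archimedean 0<δ (B * ((v - u) * (v - u))))
    N = suc (N₁ ℕ.+ N₂)
    [v-u]L≤N : (v - u) * L ≤ ⟦ N ⟧
    [v-u]L≤N = <⇒≤ (<-≤-trans (proj₂ (⟦⟧-unbounded ((v - u) * L))) (⟦⟧-mono-≤ (ℕ.m≤n⇒m≤1+n (ℕ.m≤m+n N₁ N₂))))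

module Pinsker where

  open RationalArithmetic
  open Convexity
  open AlmostMonotone
  open import Data.Nat.Base as ℕ using (ℕ)
  open import Data.Rational.Base
  open import Data.Rational.Properties
  open import Relation.Binary.PropositionalEquality
  open import Tactic.RingSolver using (solve-∀)

  module _ (a b : ℕ) where

    private
      c : ℚ
      c = ⟦ a ℕ.+ b ⟧ + ⟦ a ℕ.+ b ⟧

      0≤c : 0ℚ ≤ c
      0≤c = +-mono-≤ (⟦⟧-nonNeg (a ℕ.+ b)) (⟦⟧-nonNeg (a ℕ.+ b))

    module _ (v : ℚ) (m : ℕ) where

      -- For v = a / (a + b), Φ u ≤ Φ v reads exp(2(a+b)(v-u)²) u^a (1-u)^b ≤ v^a (1-v)^b,
      -- i.e. Pinsker's inequality KL(v ‖ u) ≥ 2(v - u)², with exp truncated to a partial sum.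
      Φ : ℚ → ℚ
      Φ x = expPartial (c * ((v - x) * (v - x))) m * (x ^ℚ a * (1ℚ - x) ^ℚ b)

      private
        curvature : ℚ
        curvature = expPartial c m * (⟦ a ⟧ * (⟦ b ⟧ + (c + c)))

      module _ {x y : ℚ} (0<x : 0ℚ < x) (x<y : x < y) (y≤v : y ≤ v) (v≤1 : v ≤ 1ℚ)
               (critical : ⟦ a ℕ.+ b ⟧ * v ≡ ⟦ a ⟧) (short : (y - x) * (c + c) ≤ 1ℚ) where

        private
          h d X e e′ A A′ B B′ P Z F : ℚ
          h = y - x
          d = v - x
          X = c * (d * d)
          e = expPartial X m
          e′ = expPartial′ X m
          A = x ^ℚ a
          A′ = powDeriv a x
          B = (1ℚ - x) ^ℚ b
          B′ = powDeriv b (1ℚ - x)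
          P = (c + c) * d * e′
          Z = A′ * B - A * B′
          F = A * B

          0≤x : 0ℚ ≤ x
          0≤x = <⇒≤ 0<x
          x≤1 : x ≤ 1ℚ
          x≤1 = ≤-trans (<⇒≤ (<-≤-trans x<y y≤v)) v≤1
          0≤y : 0ℚ ≤ y
          0≤y = ≤-trans 0≤x (<⇒≤ x<y)
          0≤h : 0ℚ ≤ h
          0≤h = p≤q⇒0≤q-p (<⇒≤ x<y)
          0≤d : 0ℚ ≤ d
          0≤d = p≤q⇒0≤q-p (≤-trans (<⇒≤ x<y) y≤v)
          d≤1 : d ≤ 1ℚ
          d≤1 = ≤-by-difference ((1ℚ - v) + x) (identity v x) (+-mono-≤ (p≤q⇒0≤q-p v≤1) 0≤x)
            where
            identity : ∀ v x → 1ℚ - (v - x) ≡ (1ℚ - v) + x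
            identity = solve-∀ ℚ-ring
          0≤1-x : 0ℚ ≤ 1ℚ - x
          0≤1-x = p≤q⇒0≤q-p x≤1
          0<1-x : 0ℚ < 1ℚ - x
          0<1-x = p<q⇒0<q-p (<-≤-trans (<-≤-trans x<y y≤v) v≤1)
          1-x≤1 : 1ℚ - x ≤ 1ℚ
          1-x≤1 = ≤-by-difference x (identity x) 0≤x
            where
            identity : ∀ x → 1ℚ - (1ℚ - x) ≡ x
            identity = solve-∀ ℚ-ring
          0≤1-y : 0ℚ ≤ 1ℚ - y
          0≤1-y = p≤q⇒0≤q-p (≤-trans y≤v v≤1)
          0≤X : 0ℚ ≤ X
          0≤X = *-pres-0≤ 0≤c (square-nonNeg d)
          0≤e′ : 0ℚ ≤ e′
          0≤e′ = expPartial′-pres-0≤ m 0≤X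
          e′≤e : e′ ≤ e
          e′≤e = expPartial′≤expPartial m 0≤X
          0≤A : 0ℚ ≤ A
          0≤A = ^ℚ-pres-0≤ a 0≤x
          0≤A′ : 0ℚ ≤ A′
          0≤A′ = powDeriv-pres-0≤ a 0≤x
          0≤B : 0ℚ ≤ B
          0≤B = ^ℚ-pres-0≤ b 0≤1-x
          0≤B′ : 0ℚ ≤ B′
          0≤B′ = powDeriv-pres-0≤ b 0≤1-x
          0≤P : 0ℚ ≤ P
          0≤P = *-pres-0≤ (*-pres-0≤ (+-mono-≤ 0≤c 0≤c) 0≤d) 0≤e′
          e≤expPartial-c : e ≤ expPartial c m
          e≤expPartial-c = expPartial-monoˡ-≤ m 0≤X
            (subst (X ≤_) (*-identityʳ c) (*-monoˡ-≤ 0≤c (subst (d * d ≤_) (*-identityʳ 1ℚ) (*-mono-≤ 0≤1 0≤d d≤1 d≤1))))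
          d*e′≤e : d * e′ ≤ e
          d*e′≤e = subst (d * e′ ≤_) (*-identityˡ e) (*-mono-≤ 0≤1 0≤e′ d≤1 e′≤e)

          e-hP≤expPartial-at-y : e - h * P ≤ expPartial (c * ((v - y) * (v - y))) m
          e-hP≤expPartial-at-y = ≤-trans (≤-by-difference (c * (h * h) * e′) (identity c v x y e e′)
              (*-pres-0≤ (*-pres-0≤ 0≤c (square-nonNeg h)) 0≤e′))
            (expPartial-tangent m 0≤X (*-pres-0≤ 0≤c (square-nonNeg (v - y))))
            where
            identity : ∀ c v x y e e′ → (e + (c * ((v - y) * (v - y)) - c * ((v - x) * (v - x))) * e′)
                                          - (e - (y - x) * ((c + c) * (v - x) * e′))
                                        ≡ c * ((y - x) * (y - x)) * e′
            identity = solve-∀ ℚ-ring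

          0≤e-hP : 0ℚ ≤ e - h * P
          0≤e-hP = p≤q⇒0≤q-p (begin
            h * P                   ≡⟨ identity h (c + c) d e′ ⟩
            (h * (c + c)) * (d * e′) ≤⟨ *-mono-≤ 0≤1 (*-pres-0≤ 0≤d 0≤e′) short d*e′≤e ⟩
            1ℚ * e                  ≡⟨ *-identityˡ e ⟩
            e                       ∎)
            where
            open ≤-Reasoning
            identity : ∀ h c₂ d e′ → h * (c₂ * d * e′) ≡ (h * c₂) * (d * e′)
            identity = solve-∀ ℚ-ring

          1-x-h*B′≤[1-y]^b : B - h * B′ ≤ (1ℚ - y) ^ℚ b
          1-x-h*B′≤[1-y]^b = subst (_≤ (1ℚ - y) ^ℚ b) (identity B x y B′) (^ℚ-tangent b 0≤1-x 0≤1-y)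
            where
            identity : ∀ B x y B′ → B + ((1ℚ - y) - (1ℚ - x)) * B′ ≡ B - (y - x) * B′
            identity = solve-∀ ℚ-ring

          Φ-at-y-lower : (e - h * P) * ((A + h * A′) * (B - h * B′)) ≤ Φ y
          Φ-at-y-lower = *-mono-≤-left (0≤e-hP) (*-pres-0≤ (^ℚ-pres-0≤ a 0≤y) (^ℚ-pres-0≤ b 0≤1-y))
            e-hP≤expPartial-at-y
            (*-mono-≤-left (+-mono-≤ 0≤A (*-pres-0≤ 0≤h 0≤A′)) (^ℚ-pres-0≤ b 0≤1-y)
              (^ℚ-tangent a 0≤x 0≤y) 1-x-h*B′≤[1-y]^b)
            where
            *-mono-≤-left : ∀ {p q r s} → 0ℚ ≤ p → 0ℚ ≤ s → p ≤ q → r ≤ s → p * r ≤ q * s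
            *-mono-≤-left 0≤p 0≤s p≤q r≤s = ≤-trans (*-monoˡ-≤ 0≤p r≤s) (*-monoʳ-≤ 0≤s p≤q)

          b≡D-Dv : ⟦ b ⟧ ≡ ⟦ a ℕ.+ b ⟧ - ⟦ a ℕ.+ b ⟧ * v
          b≡D-Dv = begin
            ⟦ b ⟧                              ≡⟨ identity ⟦ a ⟧ ⟦ b ⟧ ⟩
            (⟦ a ⟧ + ⟦ b ⟧) - ⟦ a ⟧            ≡⟨ cong₂ _-_ (⟦⟧-homo-+ a b) critical ⟨
            ⟦ a ℕ.+ b ⟧ - ⟦ a ℕ.+ b ⟧ * v      ∎
            where
            open ≡-Reasoning
            identity : ∀ a b → b ≡ (a + b) - a
            identity = solve-∀ ℚ-ring

          log-derivative : x * (1ℚ - x) * Z ≡ ⟦ a ℕ.+ b ⟧ * d * F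
          log-derivative = begin
            x * (1ℚ - x) * (A′ * B - A * B′)                                 ≡⟨ identity₁ x A′ B A B′ ⟩
            (1ℚ - x) * (x * A′) * B - x * A * ((1ℚ - x) * B′)                ≡⟨ cong₂ (λ p q → (1ℚ - x) * p * B - x * A * q)
                                                                                  (x*powDeriv a x) (x*powDeriv b (1ℚ - x)) ⟩
            (1ℚ - x) * (⟦ a ⟧ * A) * B - x * A * (⟦ b ⟧ * B)                 ≡⟨ cong₂ (λ p q → (1ℚ - x) * (p * A) * B - x * A * (q * B))
                                                                                  (sym critical) b≡D-Dv ⟩
            (1ℚ - x) * (D * v * A) * B - x * A * ((D - D * v) * B)           ≡⟨ identity₂ x D v A B ⟩
            D * (v - x) * (A * B)                                            ∎
            where
            open ≡-Reasoning
            D : ℚ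
            D = ⟦ a ℕ.+ b ⟧
            identity₁ : ∀ x A′ B A B′ → x * (1ℚ - x) * (A′ * B - A * B′) ≡ (1ℚ - x) * (x * A′) * B - x * A * ((1ℚ - x) * B′)
            identity₁ = solve-∀ ℚ-ring
            identity₂ : ∀ x D v A B → (1ℚ - x) * (D * v * A) * B - x * A * ((D - D * v) * B) ≡ D * (v - x) * (A * B)
            identity₂ = solve-∀ ℚ-ring

          0≤Z : 0ℚ ≤ Z
          0≤Z = *-cancelˡ-≤-pos (x * (1ℚ - x)) {{positive (*-pres-0< 0<x 0<1-x)}}
            (subst₂ _≤_ (sym (*-zeroʳ (x * (1ℚ - x)))) (sym log-derivative)
              (*-pres-0≤ (*-pres-0≤ (⟦⟧-nonNeg (a ℕ.+ b)) 0≤d) (*-pres-0≤ 0≤A 0≤B)))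

          -- e * Z - P * F is the derivative of Φ at x; it is nonnegative since 4x(1 - x) ≤ 1.
          0≤Φ′ : 0ℚ ≤ e * Z - P * F
          0≤Φ′ = subst (0ℚ ≤_) (sym Φ′≡) (+-mono-≤ (*-pres-0≤ (p≤q⇒0≤q-p e′≤e) 0≤Z)
            (*-pres-0≤ 0≤e′ (*-pres-0≤ 0≤Z (square-nonNeg (1ℚ - (x + x))))))
            where
            Φ′≡ : e * Z - P * F ≡ (e - e′) * Z + e′ * (Z * ((1ℚ - (x + x)) * (1ℚ - (x + x))))
            Φ′≡ = begin
              e * Z - ((D + D) + (D + D)) * d * e′ * F              ≡⟨ identity₁ e Z D d e′ F ⟩
              e * Z - (1ℚ + 1ℚ + 1ℚ + 1ℚ) * e′ * (D * d * F)        ≡⟨ cong (λ t → e * Z - (1ℚ + 1ℚ + 1ℚ + 1ℚ) * e′ * t) log-derivative ⟨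
              e * Z - (1ℚ + 1ℚ + 1ℚ + 1ℚ) * e′ * (x * (1ℚ - x) * Z) ≡⟨ identity₂ e Z e′ x ⟩
              (e - e′) * Z + e′ * (Z * ((1ℚ - (x + x)) * (1ℚ - (x + x)))) ∎
              where
              open ≡-Reasoning
              D : ℚ
              D = ⟦ a ℕ.+ b ⟧
              identity₁ : ∀ e Z D d e′ F → e * Z - ((D + D) + (D + D)) * d * e′ * F ≡ e * Z - (1ℚ + 1ℚ + 1ℚ + 1ℚ) * e′ * (D * d * F)
              identity₁ = solve-∀ ℚ-ring
              identity₂ : ∀ e Z e′ x → e * Z - (1ℚ + 1ℚ + 1ℚ + 1ℚ) * e′ * (x * (1ℚ - x) * Z)
                                     ≡ (e - e′) * Z + e′ * (Z * ((1ℚ - (x + x)) * (1ℚ - (x + x))))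
              identity₂ = solve-∀ ℚ-ring

          second-order-slack : 0ℚ ≤ curvature - e * A′ * B′ - P * A′ * B
          second-order-slack = subst (0ℚ ≤_) (identity curvature (e * A′ * B′) (P * A′ * B)) (p≤q⇒0≤q-p (begin
            e * A′ * B′ + P * A′ * B
              ≤⟨ +-mono-≤ (*-mono-≤ (*-pres-0≤ 0≤Ec (⟦⟧-nonNeg a)) 0≤B′ (*-mono-≤ 0≤Ec 0≤A′ e≤expPartial-c A′≤a) B′≤b)
                          (*-mono-≤ (*-pres-0≤ 0≤2cEc (⟦⟧-nonNeg a)) 0≤B (*-mono-≤ 0≤2cEc 0≤A′ P≤2cEc A′≤a) B≤1) ⟩
            Ec * ⟦ a ⟧ * ⟦ b ⟧ + (c + c) * Ec * ⟦ a ⟧ * 1ℚ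
              ≡⟨ identity₂ Ec ⟦ a ⟧ ⟦ b ⟧ (c + c) ⟩
            curvature ∎))
            where
            open ≤-Reasoning
            Ec : ℚ
            Ec = expPartial c m
            0≤Ec : 0ℚ ≤ Ec
            0≤Ec = expPartial-pres-0≤ m 0≤c
            0≤2cEc : 0ℚ ≤ (c + c) * Ec
            0≤2cEc = *-pres-0≤ (+-mono-≤ 0≤c 0≤c) 0≤Ec
            A′≤a : A′ ≤ ⟦ a ⟧
            A′≤a = powDeriv≤n a 0≤x x≤1
            B′≤b : B′ ≤ ⟦ b ⟧
            B′≤b = powDeriv≤n b 0≤1-x 1-x≤1
            B≤1 : B ≤ 1ℚ
            B≤1 = ^ℚ-≤1 b 0≤1-x 1-x≤1
            P≤2cEc : P ≤ (c + c) * Ec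
            P≤2cEc = subst (_≤ (c + c) * Ec) (sym (*-assoc (c + c) d e′))
              (*-monoˡ-≤ (+-mono-≤ 0≤c 0≤c) (≤-trans d*e′≤e e≤expPartial-c))
            identity : ∀ B p q → B - (p + q) ≡ B - p - q
            identity = solve-∀ ℚ-ring
            identity₂ : ∀ E a b c₂ → E * a * b + c₂ * E * a * 1ℚ ≡ E * (a * (b + c₂))
            identity₂ = solve-∀ ℚ-ring

        -- Second-order expansion of Φ from x to y, using tangent-line lower bounds for its three factors.
        Φ-step : Φ x - curvature * ((y - x) * (y - x)) ≤ Φ y
        Φ-step = ≤-trans (≤-by-difference _ expansion 0≤expansion) Φ-at-y-lower
          where
          expansion : (e - h * P) * ((A + h * A′) * (B - h * B′)) - (e * F - curvature * (h * h))
                      ≡ h * (e * Z - P * F) + h * h * (curvature - e * A′ * B′ - P * A′ * B)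
                        + h * h * (P * A * B′) + h * h * h * (P * A′ * B′)
          expansion = identity e h P A A′ B B′ curvature
            where
            identity : ∀ e h P A A′ B B′ κ → (e - h * P) * ((A + h * A′) * (B - h * B′)) - (e * (A * B) - κ * (h * h))
                       ≡ h * (e * (A′ * B - A * B′) - P * (A * B)) + h * h * (κ - e * A′ * B′ - P * A′ * B)
                         + h * h * (P * A * B′) + h * h * h * (P * A′ * B′)
            identity = solve-∀ ℚ-ring
          0≤expansion : 0ℚ ≤ h * (e * Z - P * F) + h * h * (curvature - e * A′ * B′ - P * A′ * B)
                             + h * h * (P * A * B′) + h * h * h * (P * A′ * B′)
          0≤expansion = +-mono-≤ (+-mono-≤ (+-mono-≤ (*-pres-0≤ 0≤h 0≤Φ′) (*-pres-0≤ 0≤h² second-order-slack))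
            (*-pres-0≤ 0≤h² (*-pres-0≤ (*-pres-0≤ 0≤P 0≤A) 0≤B′)))
            (*-pres-0≤ (*-pres-0≤ 0≤h² 0≤h) (*-pres-0≤ (*-pres-0≤ 0≤P 0≤A′) 0≤B′))
            where
            0≤h² : 0ℚ ≤ h * h
            0≤h² = square-nonNeg h

      pinsker : ∀ {u} → 0ℚ < u → u < v → v ≤ 1ℚ → ⟦ a ℕ.+ b ⟧ * v ≡ ⟦ a ⟧ → Φ u ≤ Φ v
      pinsker {u} 0<u u<v v≤1 critical = almostIncreasing⇒≤ {L = c + c} {B = curvature} u<v
        (λ u≤x x<y y≤v short → Φ-step (<-≤-trans 0<u u≤x) x<y y≤v v≤1 critical short)

module ProductWeights where

  open RationalArithmetic
  open import Data.Bool.Base using (Bool; true; false)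
  open import Data.Nat.Base as ℕ using (ℕ; suc)
  import Data.Nat.Properties as ℕ
  open import Data.Rational.Base hiding (∣_∣)
  open import Data.Rational.Properties
  open import Data.Fin.Subset using (Subset; _∩_; _─_; ∁; ∣_∣)
  open import Data.List.Base using (List; []; _∷_; length)
  open import Data.List.Relation.Unary.All as All using (All; []; _∷_)
  open import Data.List.Relation.Unary.AllPairs using ([]; _∷_)
  open import Data.List.Relation.Unary.Unique.Propositional using (Unique)
  open import Data.Vec.Base using (Vec; []; _∷_; map)
  import Data.Vec.Relation.Unary.All as Vec
  open import Data.Empty using (⊥-elim)
  open import Data.Product.Base using (_×_; _,_)
  open import Data.Fin.Subset.Properties using (∣∁p∣≡n∸∣p∣)
  open import Relation.Binary.PropositionalEquality
  open import Relation.Nullary.Negation using (¬_)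
  open import Tactic.RingSolver using (solve-∀)

  private
    variable
      n : ℕ

  prodWeight : Vec (Bool → ℚ) n → Subset n → ℚ
  prodWeight []       []      = 1ℚ
  prodWeight (w ∷ ws) (c ∷ C) = w c * prodWeight ws C

  totalWeight : Vec (Bool → ℚ) n → ℚ
  totalWeight []       = 1ℚ
  totalWeight (w ∷ ws) = (w true + w false) * totalWeight ws

  weightOf : Vec (Bool → ℚ) n → List (Subset n) → ℚ
  weightOf ws []      = 0ℚ
  weightOf ws (C ∷ L) = prodWeight ws C + weightOf ws L

  tailsWith : Bool → List (Subset (suc n)) → List (Subset n)
  tailsWith b              []                = []
  tailsWith true  ((true  ∷ C) ∷ L) = C ∷ tailsWith true L
  tailsWith false ((false ∷ C) ∷ L) = C ∷ tailsWith false L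
  tailsWith true  ((false ∷ C) ∷ L) = tailsWith true L
  tailsWith false ((true  ∷ C) ∷ L) = tailsWith false L

  tailsWith-≢ : ∀ b {C : Subset n} L → All (λ D → ¬ b ∷ C ≡ D) L → All (λ D → ¬ C ≡ D) (tailsWith b L)
  tailsWith-≢ b     []                []          = []
  tailsWith-≢ true  ((true  ∷ D) ∷ L) (C≢D ∷ C≢L) = (λ C≡D → C≢D (cong (true ∷_) C≡D)) ∷ tailsWith-≢ true L C≢L
  tailsWith-≢ false ((false ∷ D) ∷ L) (C≢D ∷ C≢L) = (λ C≡D → C≢D (cong (false ∷_) C≡D)) ∷ tailsWith-≢ false L C≢L
  tailsWith-≢ true  ((false ∷ D) ∷ L) (_   ∷ C≢L) = tailsWith-≢ true L C≢L
  tailsWith-≢ false ((true  ∷ D) ∷ L) (_   ∷ C≢L) = tailsWith-≢ false L C≢L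

  tailsWith-unique : ∀ b (L : List (Subset (suc n))) → Unique L → Unique (tailsWith b L)
  tailsWith-unique b     []                []           = []
  tailsWith-unique true  ((true  ∷ C) ∷ L) (C∉L ∷ uniq) = tailsWith-≢ true L C∉L ∷ tailsWith-unique true L uniq
  tailsWith-unique false ((false ∷ C) ∷ L) (C∉L ∷ uniq) = tailsWith-≢ false L C∉L ∷ tailsWith-unique false L uniq
  tailsWith-unique true  ((false ∷ C) ∷ L) (_   ∷ uniq) = tailsWith-unique true L uniq
  tailsWith-unique false ((true  ∷ C) ∷ L) (_   ∷ uniq) = tailsWith-unique false L uniq

  weightOf-split : ∀ w (ws : Vec (Bool → ℚ) n) L →
    weightOf (w ∷ ws) L ≡ w true * weightOf ws (tailsWith true L) + w false * weightOf ws (tailsWith false L)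
  weightOf-split w ws [] = identity (w true) (w false)
    where
    identity : ∀ t f → 0ℚ ≡ t * 0ℚ + f * 0ℚ
    identity = solve-∀ ℚ-ring
  weightOf-split w ws ((true ∷ C) ∷ L) = trans (cong (w true * prodWeight ws C +_) (weightOf-split w ws L))
    (identity (w true) (prodWeight ws C) (w false) (weightOf ws (tailsWith true L)) (weightOf ws (tailsWith false L)))
    where
    identity : ∀ t W f T F → t * W + (t * T + f * F) ≡ t * (W + T) + f * F
    identity = solve-∀ ℚ-ring
  weightOf-split w ws ((false ∷ C) ∷ L) = trans (cong (w false * prodWeight ws C +_) (weightOf-split w ws L))
    (identity (w true) (prodWeight ws C) (w false) (weightOf ws (tailsWith true L)) (weightOf ws (tailsWith false L)))
    where
    identity : ∀ t W f T F → f * W + (t * T + f * F) ≡ t * T + f * (W + F)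
    identity = solve-∀ ℚ-ring

  weightOf-≤-totalWeight : (ws : Vec (Bool → ℚ) n) → Vec.All (λ w → ∀ b → 0ℚ ≤ w b) ws →
    (L : List (Subset n)) → Unique L → weightOf ws L ≤ totalWeight ws
  weightOf-≤-totalWeight [] Vec.[] []              _                  = 0≤1
  weightOf-≤-totalWeight [] Vec.[] ([] ∷ [])       _                  = ≤-reflexive (+-identityʳ 1ℚ)
  weightOf-≤-totalWeight [] Vec.[] ([] ∷ [] ∷ _)   ((≢[] ∷ _) ∷ _)    = ⊥-elim (≢[] refl)
  weightOf-≤-totalWeight (w ∷ ws) (0≤w Vec.∷ 0≤ws) L uniq = begin
    weightOf (w ∷ ws) L
      ≡⟨ weightOf-split w ws L ⟩
    w true * weightOf ws (tailsWith true L) + w false * weightOf ws (tailsWith false L)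
      ≤⟨ +-mono-≤ (*-monoˡ-≤ (0≤w true) (weightOf-≤-totalWeight ws 0≤ws _ (tailsWith-unique true L uniq)))
                  (*-monoˡ-≤ (0≤w false) (weightOf-≤-totalWeight ws 0≤ws _ (tailsWith-unique false L uniq))) ⟩
    w true * totalWeight ws + w false * totalWeight ws
      ≡⟨ *-distribʳ-+ (totalWeight ws) (w true) (w false) ⟨
    totalWeight (w ∷ ws) ∎
    where open ≤-Reasoning

  weightOf-lower : ∀ (ws : Vec (Bool → ℚ) n) {w} L → All (λ C → w ≤ prodWeight ws C) L → ⟦ length L ⟧ * w ≤ weightOf ws L
  weightOf-lower ws {w} []      []           = ≤-reflexive (*-zeroˡ w)
  weightOf-lower ws {w} (C ∷ L) (w≤C ∷ w≤L) =
    subst (_≤ weightOf ws (C ∷ L)) (sym [1+ℓ]w≡w+ℓw) (+-mono-≤ w≤C (weightOf-lower ws L w≤L))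
    where
    [1+ℓ]w≡w+ℓw : ⟦ suc (length L) ⟧ * w ≡ w + ⟦ length L ⟧ * w
    [1+ℓ]w≡w+ℓw = trans (cong (_* w) (⟦suc⟧ (length L))) (identity ⟦ length L ⟧ w)
      where
      identity : ∀ ℓ w → (1ℚ + ℓ) * w ≡ w + ℓ * w
      identity = solve-∀ ℚ-ring

  ∣p∩q∣+∣p─q∣≡∣p∣ : ∀ (p q : Subset n) → ∣ p ∩ q ∣ ℕ.+ ∣ p ─ q ∣ ≡ ∣ p ∣
  ∣p∩q∣+∣p─q∣≡∣p∣ []          []          = refl
  ∣p∩q∣+∣p─q∣≡∣p∣ (true  ∷ p) (true  ∷ q) = cong suc (∣p∩q∣+∣p─q∣≡∣p∣ p q)
  ∣p∩q∣+∣p─q∣≡∣p∣ (true  ∷ p) (false ∷ q) = trans (ℕ.+-suc ∣ p ∩ q ∣ ∣ p ─ q ∣) (cong suc (∣p∩q∣+∣p─q∣≡∣p∣ p q))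
  ∣p∩q∣+∣p─q∣≡∣p∣ (false ∷ p) (true  ∷ q) = ∣p∩q∣+∣p─q∣≡∣p∣ p q
  ∣p∩q∣+∣p─q∣≡∣p∣ (false ∷ p) (false ∷ q) = ∣p∩q∣+∣p─q∣≡∣p∣ p q

  module _ (β p q : ℚ) where

    tilt : Bool → Bool → ℚ
    tilt true  true  = β * p
    tilt true  false = (1ℚ - β) * q
    tilt false true  = β
    tilt false false = 1ℚ - β

    totalWeight-tilt : (S : Subset n) → totalWeight (map tilt S) ≡ (β * p + (1ℚ - β) * q) ^ℚ ∣ S ∣
    totalWeight-tilt []          = refl
    totalWeight-tilt (true  ∷ S) = cong ((β * p + (1ℚ - β) * q) *_) (totalWeight-tilt S)
    totalWeight-tilt (false ∷ S) = trans (cong (_* totalWeight (map tilt S)) (identity β)) (trans (*-identityˡ _) (totalWeight-tilt S))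
      where
      identity : ∀ β → β + (1ℚ - β) ≡ 1ℚ
      identity = solve-∀ ℚ-ring

    prodWeight-tilt : (S C : Subset n) →
      prodWeight (map tilt S) C ≡ β ^ℚ ∣ C ∣ * (1ℚ - β) ^ℚ ∣ ∁ C ∣ * (p ^ℚ ∣ S ∩ C ∣ * q ^ℚ ∣ S ─ C ∣)
    prodWeight-tilt []          []          = refl
    prodWeight-tilt (true  ∷ S) (true  ∷ C) = trans (cong (β * p *_) (prodWeight-tilt S C))
      (identity β p (β ^ℚ ∣ C ∣) ((1ℚ - β) ^ℚ ∣ ∁ C ∣) (p ^ℚ ∣ S ∩ C ∣) (q ^ℚ ∣ S ─ C ∣))
      where
      identity : ∀ β p b₁ b₂ p₁ q₁ → β * p * (b₁ * b₂ * (p₁ * q₁)) ≡ β * b₁ * b₂ * (p * p₁ * q₁)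
      identity = solve-∀ ℚ-ring
    prodWeight-tilt (true  ∷ S) (false ∷ C) = trans (cong ((1ℚ - β) * q *_) (prodWeight-tilt S C))
      (identity β q (β ^ℚ ∣ C ∣) ((1ℚ - β) ^ℚ ∣ ∁ C ∣) (p ^ℚ ∣ S ∩ C ∣) (q ^ℚ ∣ S ─ C ∣))
      where
      identity : ∀ β q b₁ b₂ p₁ q₁ → (1ℚ - β) * q * (b₁ * b₂ * (p₁ * q₁)) ≡ b₁ * ((1ℚ - β) * b₂) * (p₁ * (q * q₁))
      identity = solve-∀ ℚ-ring
    prodWeight-tilt (false ∷ S) (true  ∷ C) = trans (cong (β *_) (prodWeight-tilt S C))
      (identity β (β ^ℚ ∣ C ∣) ((1ℚ - β) ^ℚ ∣ ∁ C ∣) (p ^ℚ ∣ S ∩ C ∣) (q ^ℚ ∣ S ─ C ∣))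
      where
      identity : ∀ β b₁ b₂ p₁ q₁ → β * (b₁ * b₂ * (p₁ * q₁)) ≡ β * b₁ * b₂ * (p₁ * q₁)
      identity = solve-∀ ℚ-ring
    prodWeight-tilt (false ∷ S) (false ∷ C) = trans (cong ((1ℚ - β) *_) (prodWeight-tilt S C))
      (identity β (β ^ℚ ∣ C ∣) ((1ℚ - β) ^ℚ ∣ ∁ C ∣) (p ^ℚ ∣ S ∩ C ∣) (q ^ℚ ∣ S ─ C ∣))
      where
      identity : ∀ β b₁ b₂ p₁ q₁ → (1ℚ - β) * (b₁ * b₂ * (p₁ * q₁)) ≡ b₁ * ((1ℚ - β) * b₂) * (p₁ * q₁)
      identity = solve-∀ ℚ-ring

  trade-q-for-p : ∀ {p q} j t g → 0ℚ ≤ q → q ≤ p → p ^ℚ j * q ^ℚ (t ℕ.+ g) ≤ p ^ℚ (j ℕ.+ t) * q ^ℚ g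
  trade-q-for-p {p} {q} j t g 0≤q q≤p = begin
    p ^ℚ j * q ^ℚ (t ℕ.+ g)          ≡⟨ cong (p ^ℚ j *_) (^ℚ-homo-* q t g) ⟩
    p ^ℚ j * (q ^ℚ t * q ^ℚ g)       ≤⟨ *-monoˡ-≤ (^ℚ-pres-0≤ j 0≤p) (*-monoʳ-≤ (^ℚ-pres-0≤ g 0≤q) (^ℚ-monoˡ-≤ t 0≤q q≤p)) ⟩
    p ^ℚ j * (p ^ℚ t * q ^ℚ g)       ≡⟨ *-assoc (p ^ℚ j) (p ^ℚ t) (q ^ℚ g) ⟨
    p ^ℚ j * p ^ℚ t * q ^ℚ g         ≡⟨ cong (_* q ^ℚ g) (^ℚ-homo-* p j t) ⟨
    p ^ℚ (j ℕ.+ t) * q ^ℚ g          ∎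
    where
    open ≤-Reasoning
    0≤p : 0ℚ ≤ p
    0≤p = ≤-trans 0≤q q≤p

  module _ {β p q : ℚ} (0≤β : 0ℚ ≤ β) (β≤1 : β ≤ 1ℚ) (0≤q : 0ℚ ≤ q) (q≤p : q ≤ p) where

    private
      0≤1-β : 0ℚ ≤ 1ℚ - β
      0≤1-β = p≤q⇒0≤q-p β≤1
      0≤p : 0ℚ ≤ p
      0≤p = ≤-trans 0≤q q≤p

    tilt-nonNeg : ∀ s c → 0ℚ ≤ tilt β p q s c
    tilt-nonNeg true  true  = *-pres-0≤ 0≤β 0≤p
    tilt-nonNeg true  false = *-pres-0≤ 0≤1-β 0≤q
    tilt-nonNeg false true  = 0≤β
    tilt-nonNeg false false = 0≤1-β

    tilts-nonNeg : (S : Subset n) → Vec.All (λ w → ∀ c → 0ℚ ≤ w c) (map (tilt β p q) S)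
    tilts-nonNeg []      = Vec.[]
    tilts-nonNeg (s ∷ S) = tilt-nonNeg s Vec.∷ tilts-nonNeg S

    prodWeight-tilt-lower : ∀ {k j r} → j ℕ.+ r ≡ k → (S : Subset n) → ∣ S ∣ ≡ k → ∀ {C} → ∣ C ∣ ≡ k → j ℕ.≤ ∣ S ∩ C ∣ →
      β ^ℚ k * (1ℚ - β) ^ℚ (n ℕ.∸ k) * (p ^ℚ j * q ^ℚ r) ≤ prodWeight (map (tilt β p q) S) C
    prodWeight-tilt-lower {n} {k} {j} {r} j+r≡k S ∣S∣≡k {C} ∣C∣≡k j≤f with ℕ.m≤n⇒∃[o]m+o≡n j≤f
    ... | t , j+t≡f = begin
      P * (p ^ℚ j * q ^ℚ r)                                  ≡⟨ cong (λ i → P * (p ^ℚ j * q ^ℚ i)) r≡t+g ⟩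
      P * (p ^ℚ j * q ^ℚ (t ℕ.+ g))                          ≤⟨ *-monoˡ-≤ 0≤P (trade-q-for-p j t g 0≤q q≤p) ⟩
      P * (p ^ℚ (j ℕ.+ t) * q ^ℚ g)                          ≡⟨ cong (λ i → P * (p ^ℚ i * q ^ℚ g)) j+t≡f ⟩
      P * (p ^ℚ f * q ^ℚ g)                                  ≡⟨ cong₂ (λ a b → β ^ℚ a * (1ℚ - β) ^ℚ b * (p ^ℚ f * q ^ℚ g)) ∣C∣≡k ∣∁C∣≡n∸k ⟨
      β ^ℚ ∣ C ∣ * (1ℚ - β) ^ℚ ∣ ∁ C ∣ * (p ^ℚ f * q ^ℚ g)    ≡⟨ prodWeight-tilt β p q S C ⟨
      prodWeight (map (tilt β p q) S) C                      ∎
      where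
      open ≤-Reasoning
      f g : ℕ
      f = ∣ S ∩ C ∣
      g = ∣ S ─ C ∣
      P : ℚ
      P = β ^ℚ k * (1ℚ - β) ^ℚ (n ℕ.∸ k)
      0≤P : 0ℚ ≤ P
      0≤P = *-pres-0≤ (^ℚ-pres-0≤ k 0≤β) (^ℚ-pres-0≤ (n ℕ.∸ k) 0≤1-β)
      ∣∁C∣≡n∸k : ∣ ∁ C ∣ ≡ n ℕ.∸ k
      ∣∁C∣≡n∸k = trans (∣∁p∣≡n∸∣p∣ C) (cong (n ℕ.∸_) ∣C∣≡k)
      r≡t+g : r ≡ t ℕ.+ g
      r≡t+g = ℕ.+-cancelˡ-≡ j r (t ℕ.+ g) (trans j+r≡k (trans (sym ∣S∣≡k) (trans (sym (∣p∩q∣+∣p─q∣≡∣p∣ S C))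
        (trans (cong (ℕ._+ g) (sym j+t≡f)) (ℕ.+-assoc j t g)))))

    chernoff-count : ∀ {k j r} → j ℕ.+ r ≡ k → (S : Subset n) → ∣ S ∣ ≡ k →
      (L : List (Subset n)) → Unique L → All (λ C → ∣ C ∣ ≡ k × j ℕ.≤ ∣ S ∩ C ∣) L →
      ⟦ length L ⟧ * (β ^ℚ k * (1ℚ - β) ^ℚ (n ℕ.∸ k) * (p ^ℚ j * q ^ℚ r)) ≤ (β * p + (1ℚ - β) * q) ^ℚ k
    chernoff-count {n} {k} {j} {r} j+r≡k S ∣S∣≡k L uniq sizes = begin
      ⟦ length L ⟧ * (β ^ℚ k * (1ℚ - β) ^ℚ (n ℕ.∸ k) * (p ^ℚ j * q ^ℚ r))
                                        ≤⟨ weightOf-lower ws L (All.map (λ (∣C∣≡k , j≤) → prodWeight-tilt-lower j+r≡k S ∣S∣≡k ∣C∣≡k j≤) sizes) ⟩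
      weightOf ws L                     ≤⟨ weightOf-≤-totalWeight ws (tilts-nonNeg S) L uniq ⟩
      totalWeight ws                    ≡⟨ totalWeight-tilt β p q S ⟩
      (β * p + (1ℚ - β) * q) ^ℚ ∣ S ∣   ≡⟨ cong ((β * p + (1ℚ - β) * q) ^ℚ_) ∣S∣≡k ⟩
      (β * p + (1ℚ - β) * q) ^ℚ k       ∎
      where
      open ≤-Reasoning
      ws : Vec (Bool → ℚ) n
      ws = map (tilt β p q) S

module LeafBound where

  open RationalArithmetic
  open Convexity
  open Pinsker
  open ProductWeights
  open import Data.Nat.Base as ℕ using (ℕ; zero; suc)
  import Data.Nat.Properties as ℕ
  import Data.Nat.Tactic.RingSolver as ℕ-Solver
  open import Data.Rational.Base hiding (∣_∣)
  open import Data.Rational.Properties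
  open import Data.Fin.Subset using (Subset; _∩_; ∣_∣)
  open import Data.List.Base using (List; []; _∷_; length)
  open import Data.List.Relation.Unary.All as All using (All; []; _∷_)
  open import Data.List.Relation.Unary.Unique.Propositional using (Unique)
  open import Data.Product.Base using (∃; _×_; _,_; proj₁; proj₂)
  open import Data.Integer.Base using (1ℤ)
  open import Data.Fin.Subset.Properties using (∣p∩q∣≤∣p∣)
  open import Data.List.Extrema.Nat using (argmin; argmin-all; f[argmin]≤f[⊤]; f[argmin]≤f[xs])
  open import Relation.Binary.PropositionalEquality
  open import Tactic.RingSolver using (solve-∀)

  likelihood : ℕ → ℕ → ℚ → ℚ
  likelihood j r x = x ^ℚ j * (1ℚ - x) ^ℚ r

  tilted-count : ∀ {n β v} → 0ℚ < β → β < 1ℚ → β ≤ v → v ≤ 1ℚ →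
    ∀ {k j r} → j ℕ.+ r ≡ k → (S : Subset n) → ∣ S ∣ ≡ k →
    (L : List (Subset n)) → Unique L → All (λ C → ∣ C ∣ ≡ k × j ℕ.≤ ∣ S ∩ C ∣) L →
    ⟦ length L ⟧ * (β ^ℚ k * (1ℚ - β) ^ℚ (n ℕ.∸ k)) * likelihood j r v ≤ likelihood j r β
  tilted-count {n} {β} {v} 0<β β<1 β≤v v≤1 {k} {j} {r} j+r≡k S ∣S∣≡k L uniq sizes =
    *-cancelʳ-≤-pos W {{positive 0<W}} (subst₂ _≤_ count≡ total≡
      (chernoff-count (<⇒≤ 0<β) (<⇒≤ β<1) 0≤q q≤p j+r≡k S ∣S∣≡k L uniq sizes))
    where
    -- p and q are the Chernoff tilting factors v / β and (1 - v) / (1 - β), scaled by β(1 - β)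
    -- to avoid division.
    p q W : ℚ
    p = v * (1ℚ - β)
    q = β * (1ℚ - v)
    W = β ^ℚ r * (1ℚ - β) ^ℚ j
    0<1-β : 0ℚ < 1ℚ - β
    0<1-β = p<q⇒0<q-p β<1
    0<W : 0ℚ < W
    0<W = *-pres-0< (^ℚ-pres-0< r 0<β) (^ℚ-pres-0< j 0<1-β)
    0≤q : 0ℚ ≤ q
    0≤q = *-pres-0≤ (<⇒≤ 0<β) (p≤q⇒0≤q-p v≤1)
    q≤p : q ≤ p
    q≤p = ≤-by-difference (v - β) (identity v β) (p≤q⇒0≤q-p β≤v)
      where
      identity : ∀ v β → v * (1ℚ - β) - β * (1ℚ - v) ≡ v - β
      identity = solve-∀ ℚ-ring
    count≡ : ⟦ length L ⟧ * (β ^ℚ k * (1ℚ - β) ^ℚ (n ℕ.∸ k) * (p ^ℚ j * q ^ℚ r))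
           ≡ ⟦ length L ⟧ * (β ^ℚ k * (1ℚ - β) ^ℚ (n ℕ.∸ k)) * likelihood j r v * W
    count≡ = trans (cong (λ t → ⟦ length L ⟧ * (β ^ℚ k * (1ℚ - β) ^ℚ (n ℕ.∸ k) * t))
                         (cong₂ _*_ (^ℚ-distrib-* v (1ℚ - β) j) (^ℚ-distrib-* β (1ℚ - v) r)))
                   (identity ⟦ length L ⟧ (β ^ℚ k * (1ℚ - β) ^ℚ (n ℕ.∸ k)) (v ^ℚ j) ((1ℚ - β) ^ℚ j) (β ^ℚ r) ((1ℚ - v) ^ℚ r))
      where
      identity : ∀ ℓ P a b c d → ℓ * (P * ((a * b) * (c * d))) ≡ ℓ * P * (a * d) * (c * b)
      identity = solve-∀ ℚ-ring
    total≡ : (β * p + (1ℚ - β) * q) ^ℚ k ≡ likelihood j r β * W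
    total≡ = begin
      (β * p + (1ℚ - β) * q) ^ℚ k                          ≡⟨ cong (_^ℚ k) (identity₁ β v) ⟩
      (β * (1ℚ - β)) ^ℚ k                                  ≡⟨ ^ℚ-distrib-* β (1ℚ - β) k ⟩
      β ^ℚ k * (1ℚ - β) ^ℚ k                               ≡⟨ cong (λ i → β ^ℚ i * (1ℚ - β) ^ℚ i) j+r≡k ⟨
      β ^ℚ (j ℕ.+ r) * (1ℚ - β) ^ℚ (j ℕ.+ r)               ≡⟨ cong₂ _*_ (^ℚ-homo-* β j r) (^ℚ-homo-* (1ℚ - β) j r) ⟩
      (β ^ℚ j * β ^ℚ r) * ((1ℚ - β) ^ℚ j * (1ℚ - β) ^ℚ r)  ≡⟨ identity₂ (β ^ℚ j) (β ^ℚ r) ((1ℚ - β) ^ℚ j) ((1ℚ - β) ^ℚ r) ⟩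
      likelihood j r β * W                                 ∎
      where
      open ≡-Reasoning
      identity₁ : ∀ β v → β * (v * (1ℚ - β)) + (1ℚ - β) * (β * (1ℚ - v)) ≡ β * (1ℚ - β)
      identity₁ = solve-∀ ℚ-ring
      identity₂ : ∀ a b c d → (a * b) * (c * d) ≡ (a * d) * (b * c)
      identity₂ = solve-∀ ℚ-ring

  likelihood-power : ∀ j r K x → x ^ℚ (j ℕ.* K) * (1ℚ - x) ^ℚ (r ℕ.* K) ≡ likelihood j r x ^ℚ K
  likelihood-power j r K x = trans (sym (cong₂ _*_ (^ℚ-assocʳ x j K) (^ℚ-assocʳ (1ℚ - x) r K)))
    (sym (^ℚ-distrib-* (x ^ℚ j) ((1ℚ - x) ^ℚ r) K))

  pinsker-likelihood : ∀ {β v} → 0ℚ < β → β < v → v ≤ 1ℚ → ∀ {k j r} K m → j ℕ.+ r ≡ k → ⟦ k ⟧ * v ≡ ⟦ j ⟧ →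
    expPartial ((⟦ k ℕ.* K ⟧ + ⟦ k ℕ.* K ⟧) * ((v - β) * (v - β))) m * likelihood j r β ^ℚ K ≤ likelihood j r v ^ℚ K
  pinsker-likelihood {β} {v} 0<β β<v v≤1 {k} {j} {r} K m j+r≡k kv≡j =
    subst₂ _≤_ Φ-at-β Φ-at-v (pinsker (j ℕ.* K) (r ℕ.* K) v m 0<β β<v v≤1 critical)
    where
    jK+rK≡kK : j ℕ.* K ℕ.+ r ℕ.* K ≡ k ℕ.* K
    jK+rK≡kK = trans (sym (ℕ.*-distribʳ-+ K j r)) (cong (ℕ._* K) j+r≡k)
    critical : ⟦ j ℕ.* K ℕ.+ r ℕ.* K ⟧ * v ≡ ⟦ j ℕ.* K ⟧
    critical = begin
      ⟦ j ℕ.* K ℕ.+ r ℕ.* K ⟧ * v   ≡⟨ cong (λ i → ⟦ i ⟧ * v) jK+rK≡kK ⟩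
      ⟦ k ℕ.* K ⟧ * v               ≡⟨ cong (_* v) (⟦⟧-homo-* k K) ⟩
      ⟦ k ⟧ * ⟦ K ⟧ * v             ≡⟨ identity ⟦ k ⟧ ⟦ K ⟧ v ⟩
      (⟦ k ⟧ * v) * ⟦ K ⟧           ≡⟨ cong (_* ⟦ K ⟧) kv≡j ⟩
      ⟦ j ⟧ * ⟦ K ⟧                 ≡⟨ ⟦⟧-homo-* j K ⟨
      ⟦ j ℕ.* K ⟧                   ∎
      where
      open ≡-Reasoning
      identity : ∀ k K v → k * K * v ≡ (k * v) * K
      identity = solve-∀ ℚ-ring
    Φ-at-β : Φ (j ℕ.* K) (r ℕ.* K) v m β
           ≡ expPartial ((⟦ k ℕ.* K ⟧ + ⟦ k ℕ.* K ⟧) * ((v - β) * (v - β))) m * likelihood j r β ^ℚ K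
    Φ-at-β = cong₂ (λ i G → expPartial ((⟦ i ⟧ + ⟦ i ⟧) * ((v - β) * (v - β))) m * G) jK+rK≡kK (likelihood-power j r K β)
    Φ-at-v : Φ (j ℕ.* K) (r ℕ.* K) v m v ≡ likelihood j r v ^ℚ K
    Φ-at-v = begin
      Φ (j ℕ.* K) (r ℕ.* K) v m v                   ≡⟨ cong (λ x → expPartial x m * G) (identity (⟦ j ℕ.* K ℕ.+ r ℕ.* K ⟧ + ⟦ j ℕ.* K ℕ.+ r ℕ.* K ⟧) v) ⟩
      expPartial 0ℚ m * G                           ≡⟨ cong (_* G) (expPartial-zero m) ⟩
      1ℚ * G                                        ≡⟨ *-identityˡ G ⟩
      G                                             ≡⟨ likelihood-power j r K v ⟩
      likelihood j r v ^ℚ K                         ∎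
      where
      open ≡-Reasoning
      G : ℚ
      G = v ^ℚ (j ℕ.* K) * (1ℚ - v) ^ℚ (r ℕ.* K)
      identity : ∀ c v → c * ((v - v) * (v - v)) ≡ 0ℚ
      identity = solve-∀ ℚ-ring

  likelihood-pos : ∀ {v} → 0ℚ < v → ∀ {k j r} .{{_ : ℕ.NonZero k}} → j ℕ.+ r ≡ k → ⟦ k ⟧ * v ≡ ⟦ j ⟧ → 0ℚ < likelihood j r v
  likelihood-pos 0<v {j = j} {zero} _ _ = *-pres-0< (^ℚ-pres-0< j 0<v) (⟦⟧-pos 1)
  likelihood-pos {v} 0<v {k} {j} {suc r} j+r≡k kv≡j = *-pres-0< (^ℚ-pres-0< j 0<v) (^ℚ-pres-0< (suc r) (p<q⇒0<q-p v<1))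
    where
    v<1 : v < 1ℚ
    v<1 = *-cancelˡ-<-nonNeg ⟦ k ⟧ {{nonNegative (⟦⟧-nonNeg k)}}
      (subst₂ _<_ (sym kv≡j) (sym (*-identityʳ ⟦ k ⟧)) (⟦⟧-mono-< (subst (j ℕ.<_) j+r≡k (ℕ.m<m+n j ℕ.z<s))))

  bound-via-likelihoods : ∀ {x y T g₀ g₁} K m → 0ℚ ≤ x → x ≤ y → 0ℚ ≤ T → 0ℚ < g₁ →
    T * g₁ ≤ g₀ → expPartial y m * g₀ ^ℚ K ≤ g₁ ^ℚ K → expPartial x m * T ^ℚ K ≤ 1ℚ
  bound-via-likelihoods {x} {y} {T} {g₀} {g₁} K m 0≤x x≤y 0≤T 0<g₁ Tg₁≤g₀ pinsker-bound =
    *-cancelʳ-≤-pos (g₁ ^ℚ K) {{positive (^ℚ-pres-0< K 0<g₁)}} (begin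
      expPartial x m * T ^ℚ K * g₁ ^ℚ K    ≡⟨ *-assoc (expPartial x m) (T ^ℚ K) (g₁ ^ℚ K) ⟩
      expPartial x m * (T ^ℚ K * g₁ ^ℚ K)  ≡⟨ cong (expPartial x m *_) (^ℚ-distrib-* T g₁ K) ⟨
      expPartial x m * (T * g₁) ^ℚ K       ≤⟨ *-monoˡ-≤ (expPartial-pres-0≤ m 0≤x) (^ℚ-monoˡ-≤ K (*-pres-0≤ 0≤T (<⇒≤ 0<g₁)) Tg₁≤g₀) ⟩
      expPartial x m * g₀ ^ℚ K             ≤⟨ *-monoʳ-≤ (^ℚ-pres-0≤ K 0≤g₀) (expPartial-monoˡ-≤ m 0≤x x≤y) ⟩
      expPartial y m * g₀ ^ℚ K             ≤⟨ pinsker-bound ⟩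
      g₁ ^ℚ K                              ≡⟨ *-identityˡ (g₁ ^ℚ K) ⟨
      1ℚ * g₁ ^ℚ K                         ∎)
    where
    open ≤-Reasoning
    0≤g₀ : 0ℚ ≤ g₀
    0≤g₀ = ≤-trans (*-pres-0≤ 0≤T (<⇒≤ 0<g₁)) Tg₁≤g₀

  frequency : ℕ → (k : ℕ) .{{_ : ℕ.NonZero k}} → ℚ
  frequency j k = ⟦ j ⟧ * (1ℤ / k)

  k*frequency : ∀ j k .{{_ : ℕ.NonZero k}} → ⟦ k ⟧ * frequency j k ≡ ⟦ j ⟧
  k*frequency j k = trans (identity ⟦ k ⟧ ⟦ j ⟧ (1ℤ / k)) (trans (cong (⟦ j ⟧ *_) (⟦⟧*1/⟦⟧≡1 k)) (*-identityʳ ⟦ j ⟧))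
    where
    identity : ∀ a b c → a * (b * c) ≡ b * (a * c)
    identity = solve-∀ ℚ-ring

  frequency-≥ : ∀ {α j k} .{{_ : ℕ.NonZero k}} → α * ⟦ k ⟧ ≤ ⟦ j ⟧ → α ≤ frequency j k
  frequency-≥ {α} {j} {k} αk≤j = *-cancelˡ-≤-pos ⟦ k ⟧ {{positive (⟦⟧-pos k)}}
    (subst₂ _≤_ (*-comm α ⟦ k ⟧) (sym (k*frequency j k)) αk≤j)

  frequency-≤1 : ∀ {j k} .{{_ : ℕ.NonZero k}} → j ℕ.≤ k → frequency j k ≤ 1ℚ
  frequency-≤1 {j} {k} j≤k = *-cancelˡ-≤-pos ⟦ k ⟧ {{positive (⟦⟧-pos k)}}
    (subst₂ _≤_ (sym (k*frequency j k)) (sym (*-identityʳ ⟦ k ⟧)) (⟦⟧-mono-≤ {j} j≤k))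

  exponent-mono : ∀ {α β v} k → β ≤ α → α ≤ v →
    ⟦ 2 ℕ.* k ℕ.* (k ℕ.+ 1) ⟧ * ((α - β) * (α - β)) ≤ (⟦ k ℕ.* (k ℕ.+ 1) ⟧ + ⟦ k ℕ.* (k ℕ.+ 1) ⟧) * ((v - β) * (v - β))
  exponent-mono {α} {β} {v} k β≤α α≤v =
    subst (λ c → ⟦ 2 ℕ.* k ℕ.* (k ℕ.+ 1) ⟧ * ((α - β) * (α - β)) ≤ c * ((v - β) * (v - β))) 2kK≡kK+kK
      (*-monoˡ-≤ (⟦⟧-nonNeg (2 ℕ.* k ℕ.* (k ℕ.+ 1))) (*-mono-≤ (≤-trans 0≤α-β α-β≤v-β) 0≤α-β α-β≤v-β α-β≤v-β))
    where
    0≤α-β : 0ℚ ≤ α - β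
    0≤α-β = p≤q⇒0≤q-p β≤α
    α-β≤v-β : α - β ≤ v - β
    α-β≤v-β = +-monoˡ-≤ (- β) α≤v
    2kK≡kK+kK : ⟦ 2 ℕ.* k ℕ.* (k ℕ.+ 1) ⟧ ≡ ⟦ k ℕ.* (k ℕ.+ 1) ⟧ + ⟦ k ℕ.* (k ℕ.+ 1) ⟧
    2kK≡kK+kK = trans (cong ⟦_⟧ (double k (k ℕ.+ 1))) (⟦⟧-homo-+ (k ℕ.* (k ℕ.+ 1)) (k ℕ.* (k ℕ.+ 1)))
      where
      double : ∀ k K → 2 ℕ.* k ℕ.* K ≡ k ℕ.* K ℕ.+ k ℕ.* K
      double = ℕ-Solver.solve-∀

  -- ℓ β^k (1-β)^(n-k) ≤ exp(-2k(α-β)²), raised to the power k + 1 as in QueryLowerBound.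
  ChernoffBound : (β α : ℚ) (n k m ℓ : ℕ) → Set
  ChernoffBound β α n k m ℓ = expPartial (⟦ 2 ℕ.* k ℕ.* (k ℕ.+ 1) ⟧ * ((α - β) * (α - β))) m
                              * (⟦ ℓ ⟧ * (β ^ℚ k * (1ℚ - β) ^ℚ (n ℕ.∸ k))) ^ℚ (k ℕ.+ 1) ≤ 1ℚ

  GoodOutput : ∀ {n} → ℕ → ℚ → Subset n → Subset n → Set
  GoodOutput k α C S = ∣ C ∣ ≡ k × ∣ S ∣ ≡ k × α * ⟦ k ⟧ ≤ ⟦ ∣ S ∩ C ∣ ⟧

  minimal-overlap : ∀ {n k α} (S C₀ : Subset n) L → All (λ C → GoodOutput k α C S) (C₀ ∷ L) →
    ∃ λ j → α * ⟦ k ⟧ ≤ ⟦ j ⟧ × j ℕ.≤ k × All (λ C → ∣ C ∣ ≡ k × j ℕ.≤ ∣ S ∩ C ∣) (C₀ ∷ L)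
  minimal-overlap {n} {k} {α} S C₀ L good@((_ , ∣S∣≡k , _) ∷ _) =
    shared Cmin ,
    argmin-all shared {P = λ C → α * ⟦ k ⟧ ≤ ⟦ shared C ⟧} (proj₂ (proj₂ (All.head good))) (All.map (λ (_ , _ , αk≤) → αk≤) (All.tail good)) ,
    subst (shared Cmin ℕ.≤_) ∣S∣≡k (∣p∩q∣≤∣p∣ S Cmin) ,
    All.zipWith (λ ((∣C∣≡k , _) , min≤) → ∣C∣≡k , min≤) (good , f[argmin]≤f[⊤] {f = shared} C₀ L ∷ f[argmin]≤f[xs] {f = shared} C₀ L)
    where
    shared : Subset n → ℕ
    shared C = ∣ S ∩ C ∣
    Cmin : Subset n
    Cmin = argmin shared C₀ L

  leaf-bound : ∀ {β α} → 0ℚ < β → β < 1ℚ → β < α → ∀ {n k} .{{_ : ℕ.NonZero k}} m →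
    (S : Subset n) (L : List (Subset n)) → Unique L → All (λ C → GoodOutput k α C S) L →
    ChernoffBound β α n k m (length L)
  leaf-bound {β} {α} _ _ _ {n} {k} m S [] _ _ =
    ≤-trans (≤-reflexive (trans (cong (λ i → E * (0ℚ * P) ^ℚ i) (ℕ.+-comm k 1)) (identity E P ((0ℚ * P) ^ℚ k)))) 0≤1
    where
    E P : ℚ
    E = expPartial (⟦ 2 ℕ.* k ℕ.* (k ℕ.+ 1) ⟧ * ((α - β) * (α - β))) m
    P = β ^ℚ k * (1ℚ - β) ^ℚ (n ℕ.∸ k)
    identity : ∀ E P t → E * ((0ℚ * P) * t) ≡ 0ℚ
    identity = solve-∀ ℚ-ring
  leaf-bound {β} {α} 0<β β<1 β<α {n} {k} m S L@(C₀ ∷ L′) uniq good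
    with j , αk≤j , j≤k , overlaps ← minimal-overlap {k = k} {α} S C₀ L′ good
    with r , j+r≡k ← ℕ.m≤n⇒∃[o]m+o≡n j≤k =
    bound-via-likelihoods (k ℕ.+ 1) m
      (*-pres-0≤ (⟦⟧-nonNeg (2 ℕ.* k ℕ.* (k ℕ.+ 1))) (square-nonNeg (α - β)))
      (exponent-mono k (<⇒≤ β<α) α≤v)
      (*-pres-0≤ (⟦⟧-nonNeg (length L)) (*-pres-0≤ (^ℚ-pres-0≤ k (<⇒≤ 0<β)) (^ℚ-pres-0≤ (n ℕ.∸ k) (p≤q⇒0≤q-p (<⇒≤ β<1)))))
      (likelihood-pos (<-trans 0<β β<v) {k} {j} {r} j+r≡k (k*frequency j k))
      (tilted-count 0<β β<1 (<⇒≤ β<v) v≤1 {k} {j} {r} j+r≡k S (proj₁ (proj₂ (All.head good))) L uniq overlaps)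
      (pinsker-likelihood 0<β β<v v≤1 {k} {j} {r} (k ℕ.+ 1) m j+r≡k (k*frequency j k))
    where
    v : ℚ
    v = frequency j k
    α≤v : α ≤ v
    α≤v = frequency-≥ {j = j} αk≤j
    v≤1 : v ≤ 1ℚ
    v≤1 = frequency-≤1 {j} j≤k
    β<v : β < v
    β<v = <-≤-trans β<α α≤v

module DecisionTree where

  open import Data.Nat.Base using (ℕ; zero; suc; _+_; _*_; _^_; _≤_; _<_; z≤n; s≤s; >-nonZero)
  open import Data.Nat.Properties
  open import Data.Fin.Subset using (Subset; _∩_; ∣_∣)
  open import Data.Fin.Subset.Properties using (∣p∩q∣≤∣q∣)
  open import Data.List.Base using (List; []; _∷_; length; filter)
  open import Data.List.Properties using (filter-accept; filter-reject; filter-all; filter-none)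
  open import Data.List.Relation.Unary.All as All using (All; []; _∷_)
  open import Data.List.Relation.Unary.All.Properties as All using (all-filter)
  open import Data.List.Relation.Unary.Unique.Propositional using (Unique)
  import Data.List.Relation.Unary.Unique.Propositional.Properties as Unique
  import Data.List.Relation.Unary.AllPairs as AllPairs
  open import Data.Product.Base using (Σ-syntax; ∃; _×_; _,_)
  open import Relation.Binary.Definitions using (tri<; tri≈; tri>)
  open import Relation.Binary.PropositionalEquality
  open import Relation.Nullary.Decidable.Core using (yes; no)

  module _ {A : Set} (f : A → ℕ) where

    withLabel : ℕ → List A → List A
    withLabel j = filter (λ x → f x ≟ j)

    labelledBelow : ℕ → List A → List A
    labelledBelow K = filter (λ x → f x <? K)

    length-labelledBelow-suc : ∀ K xs →
      length (labelledBelow (suc K) xs) ≡ length (labelledBelow K xs) + length (withLabel K xs)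
    length-labelledBelow-suc K []       = refl
    length-labelledBelow-suc K (x ∷ xs) with <-cmp (f x) K
    ... | tri< fx<K fx≢K _ rewrite filter-accept (λ x → f x <? suc K) {x} {xs} (m≤n⇒m≤1+n fx<K)
                                 | filter-accept (λ x → f x <? K) {x} {xs} fx<K
                                 | filter-reject (λ x → f x ≟ K) {x} {xs} fx≢K
                                 = cong suc (length-labelledBelow-suc K xs)
    ... | tri≈ fx≮K fx≡K _ rewrite filter-accept (λ x → f x <? suc K) {x} {xs} (s≤s (≤-reflexive fx≡K))
                                 | filter-reject (λ x → f x <? K) {x} {xs} fx≮K
                                 | filter-accept (λ x → f x ≟ K) {x} {xs} fx≡K
                                 = trans (cong suc (length-labelledBelow-suc K xs)) (sym (+-suc _ _))
    ... | tri> _ fx≢K K<fx rewrite filter-reject (λ x → f x <? suc K) {x} {xs} (λ fx<1+K → <⇒≱ K<fx (≤-pred fx<1+K))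
                                 | filter-reject (λ x → f x <? K) {x} {xs} (λ fx<K → <⇒≱ fx<K (<⇒≤ K<fx))
                                 | filter-reject (λ x → f x ≟ K) {x} {xs} fx≢K
                                 = length-labelledBelow-suc K xs

    pigeonhole-below : ∀ K xs → ∃ λ j → length (labelledBelow K xs) ≤ K * length (withLabel j xs)
    pigeonhole-below zero    xs = 0 , ≤-reflexive (cong length (filter-none (λ x → f x <? 0) (All.universal (λ _ ()) xs)))
    pigeonhole-below (suc K) xs with pigeonhole-below K xs
    ... | j , below≤ with length (withLabel K xs) ≤? length (withLabel j xs)
    ...   | yes cK≤cj = j , (begin
      length (labelledBelow (suc K) xs)                        ≡⟨ length-labelledBelow-suc K xs ⟩
      length (labelledBelow K xs) + length (withLabel K xs)    ≤⟨ +-mono-≤ below≤ cK≤cj ⟩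
      K * length (withLabel j xs) + length (withLabel j xs)    ≡⟨ +-comm (K * length (withLabel j xs)) _ ⟩
      suc K * length (withLabel j xs)                          ∎)
      where open ≤-Reasoning
    ...   | no  cK≰cj = K , (begin
      length (labelledBelow (suc K) xs)                        ≡⟨ length-labelledBelow-suc K xs ⟩
      length (labelledBelow K xs) + length (withLabel K xs)    ≤⟨ +-monoˡ-≤ _ below≤ ⟩
      K * length (withLabel j xs) + length (withLabel K xs)    ≤⟨ +-monoˡ-≤ _ (*-monoʳ-≤ K (<⇒≤ (≰⇒> cK≰cj))) ⟩
      K * length (withLabel K xs) + length (withLabel K xs)    ≡⟨ +-comm (K * length (withLabel K xs)) _ ⟩
      suc K * length (withLabel K xs)                          ∎)
      where open ≤-Reasoning

    pigeonhole : ∀ K xs → All (λ x → f x < K) xs → ∃ λ j → length xs ≤ K * length (withLabel j xs)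
    pigeonhole K xs labels<K with pigeonhole-below K xs
    ... | j , below≤ = j , subst (λ ys → length ys ≤ K * length (withLabel j xs)) (filter-all (λ x → f x <? K) labels<K) below≤

  -- At each query, follow the answer given on the largest share (at least 1/(k+1)) of the hidden sets.
  leaves-pigeonhole : ∀ {n k} (A : Alg n) Q {P : Subset n → Set} (L : List (Subset n)) → Unique L →
    All (λ C → P C × ∣ C ∣ ≤ k × queries A C ≤ Q) L →
    Σ[ S ∈ Subset n ] Σ[ L′ ∈ List (Subset n) ]
      Unique L′ × All (λ C → P C × run A C ≡ S) L′ × length L ≤ suc k ^ Q * length L′
  leaves-pigeonhole {k = k} (output S) Q L uniq good =
    S , L , uniq , All.map (λ (PC , _) → PC , refl) good , m≤n*m (length L) (suc k ^ Q) {{>-nonZero (m^n>0 (suc k) Q)}}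
  leaves-pigeonhole (query S f) zero []      _ _                  = S , [] , AllPairs.[] , [] , z≤n
  leaves-pigeonhole (query S f) zero (_ ∷ _) _ ((_ , _ , ()) ∷ _)
  leaves-pigeonhole {n} {k} (query S f) (suc Q) {P} L uniq good =
    let j , L≤k+1*Lj = pigeonhole answer (suc k) L (All.map answer<1+k good)
        S′ , L′ , uniq′ , good′ , Lj≤ = leaves-pigeonhole (f j) Q (withLabel answer j L)
                                          (Unique.filter⁺ (λ C → answer C ≟ j) uniq) (relabel j)
    in S′ , L′ , uniq′ , unlabel j good′ , (begin
      length L                                     ≤⟨ L≤k+1*Lj ⟩
      suc k * length (withLabel answer j L)        ≤⟨ *-monoʳ-≤ (suc k) Lj≤ ⟩
      suc k * (suc k ^ Q * length L′)              ≡⟨ *-assoc (suc k) (suc k ^ Q) (length L′) ⟨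
      suc k ^ suc Q * length L′                    ∎)
    where
    open ≤-Reasoning
    answer : Subset n → ℕ
    answer C = ∣ S ∩ C ∣
    answer<1+k : ∀ {C} → P C × ∣ C ∣ ≤ k × queries (query S f) C ≤ suc Q → answer C < suc k
    answer<1+k {C} (_ , ∣C∣≤k , _) = s≤s (≤-trans (∣p∩q∣≤∣q∣ S C) ∣C∣≤k)
    relabel : ∀ j → All (λ C → (P C × answer C ≡ j) × ∣ C ∣ ≤ k × queries (f j) C ≤ Q) (withLabel answer j L)
    relabel j = All.zipWith (λ (answer≡j , (PC , ∣C∣≤k , queries≤)) →
        (PC , answer≡j) , ∣C∣≤k , subst (λ i → queries (f i) _ ≤ Q) answer≡j (≤-pred queries≤))
      (all-filter (λ C → answer C ≟ j) L , All.filter⁺ (λ C → answer C ≟ j) good)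
    unlabel : ∀ j {S′ L′} → All (λ C → (P C × answer C ≡ j) × run (f j) C ≡ S′) L′ → All (λ C → P C × run (query S f) C ≡ S′) L′
    unlabel j = All.map (λ ((PC , answer≡j) , run≡S′) → PC , trans (cong (λ i → run (f i) _) answer≡j) run≡S′)

module QueryBound where

  open RationalArithmetic
  open Convexity
  open LeafBound
  open import Data.Nat.Base as ℕ using (ℕ; zero; suc)
  import Data.Nat.Properties as ℕ
  open import Data.Rational.Base
  open import Data.Rational.Properties
  open import Data.Empty using (⊥-elim)
  open import Relation.Binary.PropositionalEquality
  open import Tactic.RingSolver using (solve-∀)

  size-nonZero : ∀ {β n k} → 0ℚ < β → 1 ℕ.≤ n → β * ⟦ n ⟧ ≡ ⟦ k ⟧ → ℕ.NonZero k
  size-nonZero {n = suc n} {k = zero}  0<β _ βn≡0 = ⊥-elim (<-irrefl (sym βn≡0) (*-pres-0< 0<β (⟦⟧-pos (suc n))))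
  size-nonZero             {k = suc k} _   _ _    = _

  leaves-power-bound : ∀ {c ℓ} k Q → 1 ℕ.≤ c → c ℕ.≤ suc k ℕ.^ Q ℕ.* ℓ →
    ⟦ c ⟧ ^ℚ k ≤ ⟦ k ℕ.+ 1 ⟧ ^ℚ (k ℕ.* Q) * ⟦ ℓ ⟧ ^ℚ (k ℕ.+ 1)
  leaves-power-bound {c} {ℓ} k Q 1≤c c≤ = begin
    ⟦ c ⟧ ^ℚ k                                     ≤⟨ ^ℚ-monoˡ-≤ k (⟦⟧-nonNeg c) (⟦⟧-mono-≤ {c} c≤) ⟩
    ⟦ suc k ℕ.^ Q ℕ.* ℓ ⟧ ^ℚ k                     ≡⟨ cong (_^ℚ k) (trans (⟦⟧-homo-* (suc k ℕ.^ Q) ℓ) (cong (_* ⟦ ℓ ⟧) (sym (⟦⟧-homo-^ (suc k) Q)))) ⟩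
    (⟦ suc k ⟧ ^ℚ Q * ⟦ ℓ ⟧) ^ℚ k                  ≡⟨ ^ℚ-distrib-* (⟦ suc k ⟧ ^ℚ Q) ⟦ ℓ ⟧ k ⟩
    (⟦ suc k ⟧ ^ℚ Q) ^ℚ k * ⟦ ℓ ⟧ ^ℚ k             ≡⟨ cong (_* ⟦ ℓ ⟧ ^ℚ k) (trans (^ℚ-assocʳ ⟦ suc k ⟧ Q k) (cong₂ (λ a b → ⟦ a ⟧ ^ℚ b) (ℕ.+-comm 1 k) (ℕ.*-comm Q k))) ⟩
    ⟦ k ℕ.+ 1 ⟧ ^ℚ (k ℕ.* Q) * ⟦ ℓ ⟧ ^ℚ k          ≤⟨ *-monoˡ-≤ (^ℚ-pres-0≤ (k ℕ.* Q) (⟦⟧-nonNeg (k ℕ.+ 1))) (^ℚ-monoʳ-≤ 1≤ℓ (ℕ.m≤m+n k 1)) ⟩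
    ⟦ k ℕ.+ 1 ⟧ ^ℚ (k ℕ.* Q) * ⟦ ℓ ⟧ ^ℚ (k ℕ.+ 1)  ∎
    where
    open ≤-Reasoning
    1≤ℓ : 1ℚ ≤ ⟦ ℓ ⟧
    1≤ℓ = ⟦⟧-mono-≤ {1} {ℓ} (ℕ.n≢0⇒n>0 λ { refl → ℕ.<⇒≱ 1≤c (ℕ.≤-trans c≤ (ℕ.≤-reflexive (ℕ.*-zeroʳ (suc k ℕ.^ Q)))) })

  query-lower-bound : ∀ {β α n k c ℓ} Q → 0ℚ < β → β < 1ℚ → 1 ℕ.≤ n → 1 ℕ.≤ c → c ℕ.≤ suc k ℕ.^ Q ℕ.* ℓ →
    (∀ m → ChernoffBound β α n k m ℓ) → QueryLowerBound β α n k c Q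
  query-lower-bound {β} {α} {n} {k} {c} {ℓ} Q 0<β β<1 1≤n 1≤c c≤ chernoff m = begin
    E * (β ^ℚ (k ℕ.* K) * (1ℚ - β) ^ℚ (K ℕ.* (n ℕ.∸ k)) * ⟦ c ⟧ ^ℚ k)  ≡⟨ cong (λ t → E * (t * ⟦ c ⟧ ^ℚ k)) P^K≡ ⟩
    E * (P ^ℚ K * ⟦ c ⟧ ^ℚ k)                                          ≤⟨ *-monoˡ-≤ 0≤E (*-monoˡ-≤ (^ℚ-pres-0≤ K 0≤P) (leaves-power-bound k Q 1≤c c≤)) ⟩
    E * (P ^ℚ K * (R * ⟦ ℓ ⟧ ^ℚ K))                                    ≡⟨ identity E (P ^ℚ K) R (⟦ ℓ ⟧ ^ℚ K) ⟩
    R * (E * (⟦ ℓ ⟧ ^ℚ K * P ^ℚ K))                                    ≡⟨ cong (λ t → R * (E * t)) (^ℚ-distrib-* ⟦ ℓ ⟧ P K) ⟨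
    R * (E * (⟦ ℓ ⟧ * P) ^ℚ K)                                         ≤⟨ *-monoˡ-≤ 0≤R (chernoff m) ⟩
    R * 1ℚ                                                             ≤⟨ *-monoˡ-≤ 0≤R (subst (_≤ ⟦ n ⟧ ^ℚ K) (1^ℚ K) (^ℚ-monoˡ-≤ K 0≤1 (⟦⟧-mono-≤ {1} {n} 1≤n))) ⟩
    R * ⟦ n ⟧ ^ℚ K                                                     ∎
    where
    open ≤-Reasoning
    K : ℕ
    K = k ℕ.+ 1
    E P R : ℚ
    E = expPartial (⟦ 2 ℕ.* k ℕ.* K ⟧ * ((α - β) * (α - β))) m
    P = β ^ℚ k * (1ℚ - β) ^ℚ (n ℕ.∸ k)
    R = ⟦ K ⟧ ^ℚ (k ℕ.* Q)
    0≤E : 0ℚ ≤ E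
    0≤E = expPartial-pres-0≤ m (*-pres-0≤ (⟦⟧-nonNeg (2 ℕ.* k ℕ.* K)) (square-nonNeg (α - β)))
    0≤P : 0ℚ ≤ P
    0≤P = *-pres-0≤ (^ℚ-pres-0≤ k (<⇒≤ 0<β)) (^ℚ-pres-0≤ (n ℕ.∸ k) (p≤q⇒0≤q-p (<⇒≤ β<1)))
    0≤R : 0ℚ ≤ R
    0≤R = ^ℚ-pres-0≤ (k ℕ.* Q) (⟦⟧-nonNeg K)
    P^K≡ : β ^ℚ (k ℕ.* K) * (1ℚ - β) ^ℚ (K ℕ.* (n ℕ.∸ k)) ≡ P ^ℚ K
    P^K≡ = trans (cong₂ _*_ (sym (^ℚ-assocʳ β k K)) (trans (cong ((1ℚ - β) ^ℚ_) (ℕ.*-comm K (n ℕ.∸ k))) (sym (^ℚ-assocʳ (1ℚ - β) (n ℕ.∸ k) K))))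
                 (sym (^ℚ-distrib-* (β ^ℚ k) ((1ℚ - β) ^ℚ (n ℕ.∸ k)) K))
    identity : ∀ e p r l → e * (p * (r * l)) ≡ r * (e * (l * p))
    identity = solve-∀ ℚ-ring

open import Data.Nat using (ℕ; _≤_)
open import Data.Rational using (ℚ; 0ℚ; 1ℚ; _<_; _*_) renaming (_≤_ to _≤ℚ_)
open import Data.Fin.Subset using (Subset; ∣_∣)
open import Data.List using (List; _∷_; length)
open import Data.List.Relation.Unary.All using (All)
open import Data.List.Relation.Unary.Unique.Propositional using (Unique)
open import Data.List.Membership.Propositional using (_∈_)
open import Data.Product using (Σ; _×_)
open import Relation.Binary.PropositionalEquality using (_≡_; _≢_)

open import Data.Nat using (NonZero; s≤s; z≤n)
open import Data.Nat.Properties using (≤-reflexive)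
open import Data.Empty using (⊥-elim)
open import Data.Product using (_,_)
import Data.List.Relation.Unary.All as All
open import Data.List.Relation.Unary.Any using (here; there)
open import Data.List.Extrema.Nat using (argmax; argmax-all; f[⊥]≤f[argmax]; f[xs]≤f[argmax])
open import Relation.Binary.PropositionalEquality using (refl; subst)
open DecisionTree using (leaves-pigeonhole)
open LeafBound using (GoodOutput; leaf-bound)
open QueryBound

proposition2 : (β : ℚ) → 0ℚ < β → β < 1ℚ →
  (n k : ℕ) → 1 ≤ n → β * ⟦ n ⟧ ≡ ⟦ k ⟧ →
  (𝒞 : List (Subset n)) → 𝒞 ≢ List.[] → Unique 𝒞 → All (λ C → ∣ C ∣ ≡ k) 𝒞 →
  (α : ℚ) → β < α → α ≤ℚ 1ℚ →
  (A : Alg n) → IsApprox k 𝒞 α A →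
  Σ (Subset n) λ C* → C* ∈ 𝒞 × QueryLowerBound β α n k (length 𝒞) (queries A C*)
proposition2 β 0<β β<1 n k 1≤n βn≡k List.[] 𝒞≢[] _ _ _ _ _ _ _ = ⊥-elim (𝒞≢[] refl)
proposition2 β 0<β β<1 n k 1≤n βn≡k 𝒞@(C₀ ∷ Cs) _ uniq sizes α β<α _ A approx =
  let S , L , uniq-L , outputs≡S , 𝒞≤ = leaves-pigeonhole A Q 𝒞 uniq (All.tabulate premises)
  in C* , C*∈𝒞 , query-lower-bound {α = α} Q 0<β β<1 1≤n (s≤s z≤n) 𝒞≤
       (λ m → leaf-bound 0<β β<1 β<α m S L uniq-L
                (All.map (λ (goodC , run≡S) → subst (GoodOutput k α _) run≡S goodC) outputs≡S))
  where
  instance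
    k≢0 : NonZero k
    k≢0 = size-nonZero 0<β 1≤n βn≡k
  C* : Subset n
  C* = argmax (queries A) C₀ Cs
  C*∈𝒞 : C* ∈ 𝒞
  C*∈𝒞 = argmax-all (queries A) {P = _∈ 𝒞} (here refl) (All.tabulate there)
  Q : ℕ
  Q = queries A C*
  premises : ∀ {C} → C ∈ 𝒞 → GoodOutput k α C (run A C) × ∣ C ∣ ≤ k × queries A C ≤ Q
  premises {C} C∈𝒞 = (All.lookup sizes C∈𝒞 , approx C C∈𝒞) , ≤-reflexive (All.lookup sizes C∈𝒞) ,
    All.lookup (f[⊥]≤f[argmax] {f = queries A} C₀ Cs All.∷ f[xs]≤f[argmax] {f = queries A} C₀ Cs) C∈𝒞
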